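{- Let $A$ be a set of vertices of the $n$-cycle $C_n$ with $2\leq |A|=m\leq n$. The following are equivalent: (1) $A$ is a maximizer of $W$ on $C_n$. (2) $A$ is a local maximizer of $W$ on $C_n$. (3) If $m$ is odd then $\mathrm{supp}(\sigma^*_{\lfloor m/2\rfloor}(A))\subseteq\{1,\ldots,\lfloor n/2\rfloor\}$, and if $m$ is even then $\mathrm{supp}(\sigma^*_{m/2}(A))\subseteq\{\lfloor n/2\rfloor,\lceil n/2\rceil\}$. (4) For all integers $k$ with $1\leq k<\frac{m}{2}$ we have $\sigma_k(A)=\sigma^*_k(A)$, and, if $m$ is even, $\mathrm{supp}(\sigma_{m/2}(A))=\{\lfloor n/2\rfloor\}$.
   Context: The vertices of $C_n$ are $0,\ldots,n-1$ (mod $n$), arranged clockwise, $u$ adjacent to $u\pm1$; $d(u,v)$ is the geodesic distance and $d^*(u,v)$ the least non-negative integer congruent to $v-u$ mod $n$. $W(X)=\sum_{\{u,v\}\subseteq X,\,u\neq v} d(u,v)$. $A$ is a maximizer of $W$ if $W(A)=\max\{W(B):|B|=|A|\}$; a perturbation of $A$ is $(A\setminus\{u\})\cup\{v\}$ with $u\in A$, $v\notin A$, $\{u,v\}$ an edge, and $A$ is a local maximizer if $W(A)=\max\{W(B): B\text{ a perturbation of }A\}$. Writing $A=\{a_0<\cdots<a_{m-1}\}$, $\mathrm{span}_A(a_i,a_j)$ is the least positive integer congruent to $j-i$ mod $m$. For $1\leq k\leq m-1$: $\sigma^*_k(A)=[\,d^*(u,v): u,v\in A, u\neq v, \mathrm{span}_A(u,v)=k\,]$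 and $\sigma_k(A)=[\,d(u,v): u,v\in A, u\neq v, \mathrm{span}_A(u,v)=k\,]$ (multisets over ordered pairs). $\mathrm{supp}$ of a multiset is the set of its distinct elements. -}

module Defs where

open import Data.Bool using (Bool; true; false; _∧_; not; if_then_else_)
open import Data.Nat using (ℕ; zero; suc; _+_; _*_; _∸_; _≤_; _<_; _⊓_; _≡ᵇ_; _<ᵇ_; _≤ᵇ_; _/_; _%_)
open import Data.Fin using (Fin; toℕ)
open import Data.Fin.Subset using (Subset; _∈_; _∉_; _∪_; _─_; ⁅_⁆; ∣_∣)
open import Data.Vec using (lookup)
open import Data.List using (List; []; _∷_; [_]; concatMap; allFin; map)
open import Data.Nat.ListAction using (sum)
open import Data.List.Membership.Propositional using () renaming (_∈_ to _∈ₗ_)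
open import Data.List.Relation.Binary.Permutation.Propositional using (_↭_)
open import Data.Product using (Σ; ∃; _×_; _,_)
open import Relation.Binary.PropositionalEquality using (_≡_)

dstar : ∀ {n} → Fin n → Fin n → ℕ
dstar {n} u v = if toℕ u ≤ᵇ toℕ v then toℕ v ∸ toℕ u else (n + toℕ v) ∸ toℕ u

dist : ∀ {n} → Fin n → Fin n → ℕ
dist u v = dstar u v ⊓ dstar v u

inA : ∀ {n} → Subset n → Fin n → Bool
inA A u = lookup A u

W : ∀ {n} → Subset n → ℕ
W {n} X = sum (concatMap (λ u → map (λ v →
            if inA X u ∧ inA X v ∧ (toℕ u <ᵇ toℕ v) then dist u v else 0)
            (allFin n)) (allFin n))

Maximizer : ∀ {n} → Subset n → Set
Maximizer {n} A = (B : Subset n) → ∣ B ∣ ≡ ∣ A ∣ → W B ≤ W A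

Perturbation : ∀ {n} → Subset n → Subset n → Set
Perturbation {n} A B = Σ (Fin n) λ u → Σ (Fin n) λ v →
  u ∈ A × v ∉ A × dist u v ≡ 1 × B ≡ (A ─ ⁅ u ⁆) ∪ ⁅ v ⁆

LocalMaximizer : ∀ {n} → Subset n → Set
LocalMaximizer {n} A = (B : Subset n) → Perturbation A B → W B ≤ W A

rank : ∀ {n} → Subset n → Fin n → ℕ
rank {n} A u = sum (map (λ w → if inA A w ∧ (toℕ w <ᵇ toℕ u) then 1 else 0) (allFin n))

spanA : ∀ {n} → Subset n → Fin n → Fin n → ℕ
spanA A u v = if rank A u <ᵇ rank A v then rank A v ∸ rank A u
              else (∣ A ∣ + rank A v) ∸ rank A u

-- multiset (as a list, over ordered pairs (u,v), u ≠ v in A, span k) of f(u,v)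
sigmaWith : ∀ {n} → (Fin n → Fin n → ℕ) → Subset n → ℕ → List ℕ
sigmaWith {n} f A k = concatMap (λ u → concatMap (λ v →
    if inA A u ∧ inA A v ∧ not (toℕ u ≡ᵇ toℕ v) ∧ (spanA A u v ≡ᵇ k)
    then [ f u v ] else []) (allFin n)) (allFin n)

σ* : ∀ {n} → Subset n → ℕ → List ℕ
σ* = sigmaWith dstar

σ : ∀ {n} → Subset n → ℕ → List ℕ
σ = sigmaWith dist

Cond3 : ∀ {n} → ℕ → Subset n → Set
Cond3 {n} m A =
  (m % 2 ≡ 1 → ∀ x → x ∈ₗ σ* A (m / 2) → 1 ≤ x × x ≤ n / 2) ×
  (m % 2 ≡ 0 → ∀ x → x ∈ₗ σ* A (m / 2) → (x ≡ n / 2) Data.Sum.⊎ (x ≡ n ∸ n / 2))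
  where import Data.Sum

Cond4 : ∀ {n} → ℕ → Subset n → Set
Cond4 {n} m A =
  (∀ k → 1 ≤ k → 2 * k < m → σ A k ↭ σ* A k) ×
  (m % 2 ≡ 0 → (∀ x → x ∈ₗ σ A (m / 2) → x ≡ n / 2) × (n / 2 ∈ₗ σ A (m / 2)))

{-# OPTIONS --safe #-}
module Submission where

-- Write A = {a_0 < … < a_{m-1}}, extended by a_{i+m} = a_i + n, and call a_{i+k} − a_i the arc of
-- span k at i; σ*_k lists these arcs and σ_k their geodesic lengths min(t, n − t). Counting ordered
-- pairs, 2W(A) = Σ_{k=1}^{m-1} sum σ_k, and telescoping gives sum σ*_k = kn. Hence sum σ_k ≤ kn
-- for 2k < m, ≤ m⌊n/2⌋ for 2k = m, and, since the span-(m−k) arc at i+k is n minus the span-k arc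
-- at i, ≤ (m−k)n for 2k > m; condition (4) says exactly that all these bounds are attained, so
-- (4) ⇒ (1), and (1) ⇒ (2) is trivial. For (2) ⇒ (3): if an arc of span ⌊m/2⌋ were too long, some
-- a_i with the same property is followed by a vertex outside A; moving a_i there shortens every arc
-- at i by one, which loses at most 1 on the short arcs and gains at least 1 on the more numerous
-- long ones, so W increases. Finally (3) ⇒ (4) because arcs of smaller span are shorter.

open import Defs
open import Data.Bool using (Bool; true; false; T; _∧_; _∨_; not; if_then_else_)
open import Data.Bool.Properties using (T-≡)
open import Data.Empty using (⊥; ⊥-elim)
open import Data.Fin as Fin using (Fin; toℕ; fromℕ<)
open import Data.Fin.Properties using (toℕ-fromℕ<; toℕ<n)
open import Data.Fin.Subset using (Subset; _∈_; _∉_; ∣_∣; ⁅_⁆; _∪_; _─_) renaming (⊥ to ∅)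
open import Data.List using (List; []; _∷_; [_]; _++_; concat; concatMap; map; applyUpTo; tabulate; allFin)
open import Data.List.Properties using (map-tabulate; map-∘; concat-++; ++-identityʳ; applyUpTo-∷ʳ)
open import Data.List.Membership.Propositional using () renaming (_∈_ to _∈ₗ_)
open import Data.List.Membership.Propositional.Properties using (∈-applyUpTo⁺; ∈-applyUpTo⁻)
open import Data.List.Relation.Binary.Permutation.Propositional using (_↭_; ↭-reflexive)
open import Data.Nat
open import Data.Nat.Properties hiding (⌊n/2⌋≤⌈n/2⌉; ⌊n/2⌋≤n)
open import Data.Nat.DivMod
open import Data.Nat.ListAction using (sum)
open import Data.Nat.ListAction.Properties using (sum-++; sum-↭)
open import Data.Nat.Tactic.RingSolver using (solve-∀)
open import Data.Product using (∃; _×_; _,_; proj₁; proj₂)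
open import Data.Sum using (_⊎_; inj₁; inj₂)
open import Data.Vec using ([]; _∷_; lookup)
open import Data.Vec.Properties using (lookup⇒[]=; []=⇒lookup)
open import Function using (_∘_; id)
open import Function.Bundles using (_⇔_; mk⇔; Equivalence)
open import Relation.Binary.Definitions using (tri<; tri≈; tri>)
open import Relation.Binary.PropositionalEquality hiding ([_])
open import Relation.Nullary using (yes; no; ¬_)

T⇒≡true : ∀ {b} → T b → b ≡ true
T⇒≡true = Equivalence.to T-≡

¬T⇒≡false : ∀ {b} → ¬ T b → b ≡ false
¬T⇒≡false {false} _ = refl
¬T⇒≡false {true}  ¬t = ⊥-elim (¬t _)

≡true⇒T : ∀ {b} → b ≡ true → T b
≡true⇒T = Equivalence.from T-≡

<ᵇ-true : ∀ {a b} → a < b → (a <ᵇ b) ≡ true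
<ᵇ-true a<b = T⇒≡true (<⇒<ᵇ a<b)

<ᵇ-false : ∀ {a b} → b ≤ a → (a <ᵇ b) ≡ false
<ᵇ-false {a} {b} b≤a = ¬T⇒≡false (λ t → ≤⇒≯ b≤a (<ᵇ⇒< a b t))

<ᵇ-true⁻ : ∀ {a b} → (a <ᵇ b) ≡ true → a < b
<ᵇ-true⁻ {a} {b} eq = <ᵇ⇒< a b (≡true⇒T eq)

≤ᵇ-true : ∀ {a b} → a ≤ b → (a ≤ᵇ b) ≡ true
≤ᵇ-true a≤b = T⇒≡true (≤⇒≤ᵇ a≤b)

≤ᵇ-false : ∀ {a b} → b < a → (a ≤ᵇ b) ≡ false
≤ᵇ-false {a} {b} b<a = ¬T⇒≡false (λ t → <⇒≱ b<a (≤ᵇ⇒≤ a b t))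

≡ᵇ-true : ∀ a → (a ≡ᵇ a) ≡ true
≡ᵇ-true a = T⇒≡true (≡⇒≡ᵇ a a refl)

≡ᵇ-false : ∀ {a b} → a ≢ b → (a ≡ᵇ b) ≡ false
≡ᵇ-false {a} {b} a≢b = ¬T⇒≡false (λ t → a≢b (≡ᵇ⇒≡ a b t))

≡ᵇ-true⁻ : ∀ {a b} → (a ≡ᵇ b) ≡ true → a ≡ b
≡ᵇ-true⁻ {a} {b} eq = ≡ᵇ⇒≡ a b (≡true⇒T eq)

[m+o]∸[n+o]≡m∸n : ∀ m n o → (m + o) ∸ (n + o) ≡ m ∸ n
[m+o]∸[n+o]≡m∸n m n o = trans (cong₂ _∸_ (+-comm m o) (+-comm n o)) ([m+n]∸[m+o]≡n∸o o m n)

[m+n]/n≡1+m/n : ∀ m n .⦃ _ : NonZero n ⦄ → (m + n) / n ≡ suc (m / n)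
[m+n]/n≡1+m/n m n = trans (m/n≡1+[m∸n]/n (m≤n+m n m)) (cong (λ x → suc (x / n)) (m+n∸n≡m m n))

t+t-mono : ∀ {s t} → s ≤ t → s + s ≤ t + t
t+t-mono s≤t = +-mono-≤ s≤t s≤t

t+t<u+u⇒t<u : ∀ t u → t + t < u + u → t < u
t+t<u+u⇒t<u t u t+t<u+u with t <? u
... | yes t<u = t<u
... | no t≮u = ⊥-elim (<⇒≱ t+t<u+u (t+t-mono (≮⇒≥ t≮u)))

t+t≤u+u⇒t≤u : ∀ {t u} → t + t ≤ u + u → t ≤ u
t+t≤u+u⇒t≤u t+t≤u+u = ≮⇒≥ (λ u<t → <⇒≱ (+-mono-< u<t u<t) t+t≤u+u)

∑ : ℕ → (ℕ → ℕ) → ℕ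
∑ zero    f = 0
∑ (suc n) f = ∑ n f + f n

∑-head : ∀ n f → ∑ (suc n) f ≡ f 0 + ∑ n (f ∘ suc)
∑-head zero    f = +-comm 0 (f 0)
∑-head (suc n) f rewrite ∑-head n f = +-assoc (f 0) (∑ n (f ∘ suc)) (f (suc n))

∑-rotate : ∀ n f → ∑ n (f ∘ suc) + f 0 ≡ ∑ n f + f n
∑-rotate n f = trans (+-comm _ (f 0)) (sym (∑-head n f))

∑-cong : ∀ n {f g : ℕ → ℕ} → (∀ i → i < n → f i ≡ g i) → ∑ n f ≡ ∑ n g
∑-cong zero    f≗g = refl
∑-cong (suc n) f≗g = cong₂ _+_ (∑-cong n (λ i i<n → f≗g i (m<n⇒m<1+n i<n))) (f≗g n ≤-refl)

∑-mono-≤ : ∀ n {f g : ℕ → ℕ} → (∀ i → i < n → f i ≤ g i) → ∑ n f ≤ ∑ n g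
∑-mono-≤ zero    f≤g = z≤n
∑-mono-≤ (suc n) f≤g = +-mono-≤ (∑-mono-≤ n (λ i i<n → f≤g i (m<n⇒m<1+n i<n))) (f≤g n ≤-refl)

∑-distrib-+ : ∀ n (f g : ℕ → ℕ) → ∑ n (λ i → f i + g i) ≡ ∑ n f + ∑ n g
∑-distrib-+ zero    f g = refl
∑-distrib-+ (suc n) f g rewrite ∑-distrib-+ n f g = +-interchange (∑ n f) (∑ n g) (f n) (g n)
  where
  +-interchange : ∀ a b c d → a + b + (c + d) ≡ a + c + (b + d)
  +-interchange = solve-∀

∑-const : ∀ n c → ∑ n (λ _ → c) ≡ n * c
∑-const zero    c = refl
∑-const (suc n) c rewrite ∑-const n c = +-comm (n * c) c

∑-zero : ∀ n → ∑ n (λ _ → 0) ≡ 0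
∑-zero n = trans (∑-const n 0) (*-zeroʳ n)

∑-comm : ∀ a b (f : ℕ → ℕ → ℕ) → ∑ a (λ i → ∑ b (f i)) ≡ ∑ b (λ j → ∑ a (λ i → f i j))
∑-comm zero    b f = sym (∑-zero b)
∑-comm (suc a) b f = trans (cong (_+ ∑ b (f a)) (∑-comm a b f))
                           (sym (∑-distrib-+ b (λ j → ∑ a (λ i → f i j)) (f a)))

∑-split : ∀ a b f → ∑ (a + b) f ≡ ∑ a f + ∑ b (λ i → f (a + i))
∑-split a zero    f rewrite +-identityʳ a = sym (+-identityʳ (∑ a f))
∑-split a (suc b) f rewrite +-suc a b | ∑-split a b f = +-assoc (∑ a f) (∑ b (λ i → f (a + i))) (f (a + b))

∑-translate : ∀ n c (f : ℕ → ℕ) → (∀ i → f (i + n) ≡ f i + c) →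
              ∀ k → ∑ n (λ i → f (i + k)) ≡ ∑ n f + k * c
∑-translate n c f drift zero =
  trans (∑-cong n (λ i _ → cong f (+-identityʳ i))) (sym (+-identityʳ _))
∑-translate n c f drift (suc k) = +-cancelʳ-≡ (f k) _ _ (begin
  ∑ n (λ i → f (i + suc k)) + f k  ≡⟨ cong (_+ f k) (∑-cong n (λ i _ → cong f (+-suc i k))) ⟩
  ∑ n (g ∘ suc) + g 0              ≡⟨ ∑-rotate n g ⟩
  ∑ n g + g n                      ≡⟨ cong₂ _+_ (∑-translate n c f drift k) (trans (cong f (+-comm n k)) (drift k)) ⟩
  ∑ n f + k * c + (f k + c)        ≡⟨ rearrange (∑ n f) (k * c) (f k) c ⟩
  ∑ n f + (c + k * c) + f k        ∎)
  where
  open ≡-Reasoning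
  g : ℕ → ℕ
  g i = f (i + k)
  rearrange : ∀ a b x y → a + b + (x + y) ≡ a + (y + b) + x
  rearrange = solve-∀

∑-translate-periodic : ∀ n (f : ℕ → ℕ) → (∀ i → f (i + n) ≡ f i) →
                       ∀ k → ∑ n (λ i → f (i + k)) ≡ ∑ n f
∑-translate-periodic n f periodic k =
  trans (∑-translate n 0 f (λ i → trans (periodic i) (sym (+-identityʳ (f i)))) k)
        (trans (cong (∑ n f +_) (*-zeroʳ k)) (+-identityʳ (∑ n f)))

∑-single : ∀ n j (f : ℕ → ℕ) → j < n → (∀ i → i < n → i ≢ j → f i ≡ 0) → ∑ n f ≡ f j
∑-single (suc n) j f j<1+n others with j ≟ n
... | yes refl = cong (_+ f j) (trans (∑-cong n (λ i i<n → others i (m<n⇒m<1+n i<n) (<⇒≢ i<n))) (∑-zero n))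
... | no j≢n = trans (cong (∑ n f +_) (others n ≤-refl (j≢n ∘ sym)))
                 (trans (+-identityʳ _)
                        (∑-single n j f (≤∧≢⇒< (s≤s⁻¹ j<1+n) j≢n) (λ i i<n → others i (m<n⇒m<1+n i<n))))

∑-δ : ∀ n j → j < n → (f : ℕ → ℕ) → ∑ n (λ i → if i ≡ᵇ j then f i else 0) ≡ f j
∑-δ n j j<n f = trans (∑-single n j _ j<n off) (cong (λ b → if b then f j else 0) (≡ᵇ-true j))
  where
  off : ∀ i → i < n → i ≢ j → (if i ≡ᵇ j then f i else 0) ≡ 0
  off i _ i≢j rewrite ≡ᵇ-false i≢j = refl

∑-if : ∀ n b (f : ℕ → ℕ) → ∑ n (λ i → if b then f i else 0) ≡ (if b then ∑ n f else 0)
∑-if n true  f = refl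
∑-if n false f = ∑-zero n

∑-insert : ∀ n (Y : ℕ → Bool) w → w < n → Y w ≡ false → (f : ℕ → ℕ) →
           ∑ n (λ i → if Y i ∨ (i ≡ᵇ w) then f i else 0) ≡ ∑ n (λ i → if Y i then f i else 0) + f w
∑-insert n Y w w<n Yw≡false f =
  trans (∑-cong n (λ i _ → split i)) (trans (∑-distrib-+ n _ _) (cong (∑ n (λ i → if Y i then f i else 0) +_) (∑-δ n w w<n f)))
  where
  split : ∀ i → (if Y i ∨ (i ≡ᵇ w) then f i else 0) ≡ (if Y i then f i else 0) + (if i ≡ᵇ w then f i else 0)
  split i with Y i in Yi | i ≡ᵇ w in i≡ᵇw
  ... | true  | true  = ⊥-elim (true≢false (trans (sym Yi) (trans (cong Y (≡ᵇ-true⁻ i≡ᵇw)) Yw≡false)))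
    where
    true≢false : true ≢ false
    true≢false ()
  ... | true  | false = sym (+-identityʳ (f i))
  ... | false | _     = refl

𝟙 : Bool → ℕ
𝟙 b = if b then 1 else 0

if-+ : ∀ b x y → (if b then x + y else 0) ≡ (if b then x else 0) + (if b then y else 0)
if-+ true  x y = refl
if-+ false x y = refl

∑-truncate : ∀ n x (f : ℕ → ℕ) → x ≤ n → ∑ n (λ i → if i <ᵇ x then f i else 0) ≡ ∑ x f
∑-truncate n x f x≤n with m≤n⇒∃[o]m+o≡n x≤n
... | o , refl = begin
  ∑ (x + o) f<x                                  ≡⟨ ∑-split x o f<x ⟩
  ∑ x f<x + ∑ o (λ i → f<x (x + i))              ≡⟨ cong₂ _+_ (∑-cong x (λ i i<x → below i<x)) (∑-cong o (λ i _ → above i)) ⟩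
  ∑ x f + ∑ o (λ _ → 0)                          ≡⟨ cong (∑ x f +_) (∑-zero o) ⟩
  ∑ x f + 0                                      ≡⟨ +-identityʳ _ ⟩
  ∑ x f                                          ∎
  where
  open ≡-Reasoning
  f<x : ℕ → ℕ
  f<x i = if i <ᵇ x then f i else 0
  below : ∀ {i} → i < x → f<x i ≡ f i
  below i<x rewrite <ᵇ-true i<x = refl
  above : ∀ i → f<x (x + i) ≡ 0
  above i rewrite <ᵇ-false {x + i} {x} (m≤m+n x i) = refl

sum-applyUpTo : ∀ n (f : ℕ → ℕ) → sum (applyUpTo f n) ≡ ∑ n f
sum-applyUpTo zero    f = refl
sum-applyUpTo (suc n) f = trans (cong (f 0 +_) (sum-applyUpTo n (f ∘ suc))) (sym (∑-head n f))

sum-concat : ∀ (xss : List (List ℕ)) → sum (concat xss) ≡ sum (map sum xss)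
sum-concat []         = refl
sum-concat (xs ∷ xss) = trans (sum-++ xs (concat xss)) (cong (sum xs +_) (sum-concat xss))

applyUpTo-cong : ∀ {A : Set} n {f g : ℕ → A} → (∀ i → i < n → f i ≡ g i) → applyUpTo f n ≡ applyUpTo g n
applyUpTo-cong zero    f≗g = refl
applyUpTo-cong (suc n) f≗g = cong₂ _∷_ (f≗g 0 z<s) (applyUpTo-cong n (λ i i<n → f≗g (suc i) (s<s i<n)))

concat-applyUpTo-[] : ∀ {A : Set} n (f : ℕ → List A) → (∀ i → i < n → f i ≡ []) → concat (applyUpTo f n) ≡ []
concat-applyUpTo-[] zero    f nil = refl
concat-applyUpTo-[] (suc n) f nil rewrite nil 0 z<s = concat-applyUpTo-[] n (f ∘ suc) (λ i i<n → nil (suc i) (s<s i<n))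

concat-applyUpTo-single : ∀ {A : Set} n j (f : ℕ → List A) → j < n → (∀ i → i < n → i ≢ j → f i ≡ []) →
                          concat (applyUpTo f n) ≡ f j
concat-applyUpTo-single (suc n) zero f _ nil =
  trans (cong (f 0 ++_) (concat-applyUpTo-[] n (f ∘ suc) (λ i i<n → nil (suc i) (s<s i<n) (λ ()))))
        (++-identityʳ (f 0))
concat-applyUpTo-single (suc n) (suc j) f j<n nil rewrite nil 0 z<s (λ ()) =
  concat-applyUpTo-single n j (f ∘ suc) (s<s⁻¹ j<n) (λ i i<n i≢j → nil (suc i) (s<s i<n) (i≢j ∘ suc-injective))

tabulate-applyUpTo : ∀ {A : Set} n (f : Fin n → A) (g : ℕ → A) → (∀ u → f u ≡ g (toℕ u)) →
                     tabulate f ≡ applyUpTo g n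
tabulate-applyUpTo zero    f g f≗g = refl
tabulate-applyUpTo (suc n) f g f≗g =
  cong₂ _∷_ (f≗g Fin.zero) (tabulate-applyUpTo n (f ∘ Fin.suc) (g ∘ suc) (f≗g ∘ Fin.suc))

map-allFin : ∀ {A : Set} n (f : Fin n → A) (g : ℕ → A) → (∀ u → f u ≡ g (toℕ u)) →
             map f (allFin n) ≡ applyUpTo g n
map-allFin n f g f≗g = trans (map-tabulate id f) (tabulate-applyUpTo n f g f≗g)

module Cycle (n : ℕ) where

  dstarℕ : ℕ → ℕ → ℕ
  dstarℕ x y = if x ≤ᵇ y then y ∸ x else (n + y) ∸ x

  distℕ : ℕ → ℕ → ℕ
  distℕ x y = dstarℕ x y ⊓ dstarℕ y x

  geodesic : ℕ → ℕ
  geodesic t = t ⊓ (n ∸ t)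

  distℕ-sym : ∀ x y → distℕ x y ≡ distℕ y x
  distℕ-sym x y = ⊓-comm (dstarℕ x y) (dstarℕ y x)

  distℕ-refl : ∀ x → distℕ x x ≡ 0
  distℕ-refl x rewrite ≤ᵇ-true (≤-refl {x}) | n∸n≡0 x = refl

  [a+n]∸b≡n∸[b∸a] : ∀ {a b} → a ≤ b → (a + n) ∸ b ≡ n ∸ (b ∸ a)
  [a+n]∸b≡n∸[b∸a] {a} {b} a≤b =
    trans (cong ((a + n) ∸_) (sym (m+[n∸m]≡n a≤b))) ([m+n]∸[m+o]≡n∸o a n (b ∸ a))

  module _ ⦃ _ : NonZero n ⦄ where

    dstarℕ-%ʳ : ∀ {a b} → a < n → a ≤ b → b < a + n → dstarℕ a (b % n) ≡ b ∸ a
    dstarℕ-%ʳ {a} {b} a<n a≤b b<a+n with b <? n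
    ... | yes b<n rewrite m<n⇒m%n≡m b<n | ≤ᵇ-true a≤b = refl
    ... | no b≮n with m≤n⇒∃[o]m+o≡n (≮⇒≥ b≮n)
    ...   | o , refl = begin
      dstarℕ a ((n + o) % n)  ≡⟨ cong (dstarℕ a) (trans (cong (_% n) (+-comm n o)) ([m+n]%n≡m%n o n)) ⟩
      dstarℕ a (o % n)        ≡⟨ cong (dstarℕ a) (m<n⇒m%n≡m (<-trans o<a a<n)) ⟩
      dstarℕ a o              ≡⟨ cong (λ c → if c then o ∸ a else (n + o) ∸ a) (≤ᵇ-false o<a) ⟩
      (n + o) ∸ a             ∎
      where
      open ≡-Reasoning
      o<a : o < a
      o<a = +-cancelʳ-< n o a (subst (_< a + n) (+-comm n o) b<a+n)

    dstarℕ-% : ∀ {a b} → a ≤ b → b < a + n → dstarℕ (a % n) (b % n) ≡ b ∸ a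
    dstarℕ-% {a} {b} a≤b b<a+n = begin
      dstarℕ (a % n) (b % n)  ≡⟨ cong (dstarℕ (a % n)) (trans (cong (_% n) b≡) ([m+kn]%n≡m%n b′ q n)) ⟩
      dstarℕ (a % n) (b′ % n) ≡⟨ dstarℕ-%ʳ (m%n<n a n) a′≤b′ b′<a′+n ⟩
      b′ ∸ a % n              ≡⟨ sym (trans (cong₂ _∸_ b≡ a≡) ([m+o]∸[n+o]≡m∸n b′ (a % n) (q * n))) ⟩
      b ∸ a                   ∎
      where
      open ≡-Reasoning
      q  = a / n
      b′ = b ∸ q * n
      a≡ : a ≡ a % n + q * n
      a≡ = m≡m%n+[m/n]*n a n
      b≡ : b ≡ b′ + q * n
      b≡ = sym (m∸n+n≡m (≤-trans (m/n*n≤m a n) a≤b))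
      a′≤b′ : a % n ≤ b′
      a′≤b′ = +-cancelʳ-≤ (q * n) (a % n) b′ (subst₂ _≤_ a≡ b≡ a≤b)
      b′<a′+n : b′ < a % n + n
      b′<a′+n = +-cancelʳ-< (q * n) b′ (a % n + n)
        (subst₂ _<_ b≡ (trans (cong (_+ n) a≡) (+-comm-middle (a % n) (q * n) n)) b<a+n)
        where
        +-comm-middle : ∀ x y z → x + y + z ≡ x + z + y
        +-comm-middle = solve-∀

  ⌊n/2⌋ : ℕ
  ⌊n/2⌋ = n / 2

  ⌈n/2⌉ : ℕ
  ⌈n/2⌉ = n ∸ ⌊n/2⌋

  n≡⌊n/2⌋+⌊n/2⌋+n%2 : n ≡ ⌊n/2⌋ + ⌊n/2⌋ + n % 2
  n≡⌊n/2⌋+⌊n/2⌋+n%2 = trans (m≡m%n+[m/n]*n n 2) (trans (+-comm (n % 2) (⌊n/2⌋ * 2)) (cong (_+ n % 2) double))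
    where
    double : ⌊n/2⌋ * 2 ≡ ⌊n/2⌋ + ⌊n/2⌋
    double = trans (*-comm ⌊n/2⌋ 2) (cong (⌊n/2⌋ +_) (+-identityʳ ⌊n/2⌋))

  ⌊n/2⌋+⌊n/2⌋≤n : ⌊n/2⌋ + ⌊n/2⌋ ≤ n
  ⌊n/2⌋+⌊n/2⌋≤n = ≤-trans (m≤m+n _ (n % 2)) (≤-reflexive (sym n≡⌊n/2⌋+⌊n/2⌋+n%2))

  n≤1+⌊n/2⌋+⌊n/2⌋ : n ≤ suc (⌊n/2⌋ + ⌊n/2⌋)
  n≤1+⌊n/2⌋+⌊n/2⌋ = begin
    n                          ≡⟨ n≡⌊n/2⌋+⌊n/2⌋+n%2 ⟩
    ⌊n/2⌋ + ⌊n/2⌋ + n % 2      ≤⟨ +-monoʳ-≤ (⌊n/2⌋ + ⌊n/2⌋) (s≤s⁻¹ (m%n<n n 2)) ⟩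
    ⌊n/2⌋ + ⌊n/2⌋ + 1          ≡⟨ +-comm _ 1 ⟩
    suc (⌊n/2⌋ + ⌊n/2⌋)        ∎
    where open ≤-Reasoning

  ⌊n/2⌋≤⌈n/2⌉ : ⌊n/2⌋ ≤ ⌈n/2⌉
  ⌊n/2⌋≤⌈n/2⌉ = m+n≤o⇒m≤o∸n ⌊n/2⌋ ⌊n/2⌋+⌊n/2⌋≤n

  ⌊n/2⌋≤n : ⌊n/2⌋ ≤ n
  ⌊n/2⌋≤n = ≤-trans (m≤m+n ⌊n/2⌋ ⌊n/2⌋) ⌊n/2⌋+⌊n/2⌋≤n

  ⌈n/2⌉≤1+⌊n/2⌋ : ⌈n/2⌉ ≤ suc ⌊n/2⌋
  ⌈n/2⌉≤1+⌊n/2⌋ = m≤n+o⇒m∸n≤o n ⌊n/2⌋ (≤-trans n≤1+⌊n/2⌋+⌊n/2⌋ (≤-reflexive (sym (+-suc ⌊n/2⌋ ⌊n/2⌋))))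

  ⌊n/2⌋≤t≤⌈n/2⌉ : ∀ {t} → ⌊n/2⌋ ≤ t → t ≤ ⌈n/2⌉ → t ≡ ⌊n/2⌋ ⊎ t ≡ ⌈n/2⌉
  ⌊n/2⌋≤t≤⌈n/2⌉ {t} low high with t ≟ ⌊n/2⌋
  ... | yes t≡ = inj₁ t≡
  ... | no t≢ = inj₂ (≤-antisym high (≤-trans ⌈n/2⌉≤1+⌊n/2⌋ (≤∧≢⇒< low (t≢ ∘ sym))))

  n∸t≤⌈n/2⌉⇒⌊n/2⌋≤t : ∀ {t} → n ∸ t ≤ ⌈n/2⌉ → ⌊n/2⌋ ≤ t
  n∸t≤⌈n/2⌉⇒⌊n/2⌋≤t n∸t≤ = ≮⇒≥ (λ t<⌊n/2⌋ → <⇒≱ (∸-monoʳ-< t<⌊n/2⌋ ⌊n/2⌋≤n) n∸t≤)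

  r+r≤n⇒r≤⌊n/2⌋ : ∀ {r} → r + r ≤ n → r ≤ ⌊n/2⌋
  r+r≤n⇒r≤⌊n/2⌋ {r} r+r≤n = s≤s⁻¹ (t+t<u+u⇒t<u r (suc ⌊n/2⌋) (s≤s (≤-trans r+r≤n (≤-trans n≤1+⌊n/2⌋+⌊n/2⌋ (≤-reflexive (sym (+-suc ⌊n/2⌋ ⌊n/2⌋)))))))

  t≤⌊n/2⌋⇒t+t≤n : ∀ {t} → t ≤ ⌊n/2⌋ → t + t ≤ n
  t≤⌊n/2⌋⇒t+t≤n t≤ = ≤-trans (t+t-mono t≤) ⌊n/2⌋+⌊n/2⌋≤n

  t<⌈n/2⌉⇒t+t≤n : ∀ {t} → t < ⌈n/2⌉ → t + t ≤ n
  t<⌈n/2⌉⇒t+t≤n {t} t<  = s≤s⁻¹ (begin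
    suc (t + t)           ≤⟨ n≤1+n _ ⟩
    suc (suc (t + t))     ≡⟨ cong suc (sym (+-suc t t)) ⟩
    suc t + suc t         ≤⟨ t+t-mono t< ⟩
    ⌈n/2⌉ + ⌈n/2⌉         ≤⟨ +-monoʳ-≤ ⌈n/2⌉ ⌈n/2⌉≤1+⌊n/2⌋ ⟩
    ⌈n/2⌉ + suc ⌊n/2⌋     ≡⟨ +-suc ⌈n/2⌉ ⌊n/2⌋ ⟩
    suc (⌈n/2⌉ + ⌊n/2⌋)   ≡⟨ cong suc (trans (+-comm ⌈n/2⌉ ⌊n/2⌋) (m+[n∸m]≡n ⌊n/2⌋≤n)) ⟩
    suc n                 ∎)
    where open ≤-Reasoning

  ⌊n/2⌋<t⇒n<t+t : ∀ {t} → ⌊n/2⌋ < t → n < t + t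
  ⌊n/2⌋<t⇒n<t+t t> = ≤-trans (s≤s n≤1+⌊n/2⌋+⌊n/2⌋)
                        (≤-trans (≤-reflexive (cong suc (sym (+-suc ⌊n/2⌋ ⌊n/2⌋)))) (t+t-mono t>))

  1+⌊n/2⌋<t⇒1+n<t+t : ∀ {t} → suc ⌊n/2⌋ < t → suc n < t + t
  1+⌊n/2⌋<t⇒1+n<t+t {suc t} (s≤s t>) =
    ≤-trans (s≤s (⌊n/2⌋<t⇒n<t+t t>)) (≤-trans (n≤1+n _) (≤-reflexive (cong suc (sym (+-suc t t)))))

  ⌈n/2⌉<t⇒1+n<t+t : ∀ {t} → ⌈n/2⌉ < t → suc n < t + t
  ⌈n/2⌉<t⇒1+n<t+t {t} t> = begin-strict
    suc n                       ≡⟨ cong suc (sym (m+[n∸m]≡n ⌊n/2⌋≤n)) ⟩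
    suc (⌊n/2⌋ + ⌈n/2⌉)         ≤⟨ s≤s (+-monoˡ-≤ ⌈n/2⌉ ⌊n/2⌋≤⌈n/2⌉) ⟩
    suc (⌈n/2⌉ + ⌈n/2⌉)         <⟨ s≤s (≤-reflexive (sym (+-suc ⌈n/2⌉ ⌈n/2⌉))) ⟩
    suc ⌈n/2⌉ + suc ⌈n/2⌉       ≤⟨ t+t-mono t> ⟩
    t + t                       ∎
    where open ≤-Reasoning

  geodesic≤ : ∀ t → geodesic t ≤ t
  geodesic≤ t = m⊓n≤m t (n ∸ t)

  geodesic≤∸ : ∀ t → geodesic t ≤ n ∸ t
  geodesic≤∸ t = m⊓n≤n t (n ∸ t)

  t+t≤n⇒geodesic≡t : ∀ {t} → t + t ≤ n → geodesic t ≡ t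
  t+t≤n⇒geodesic≡t {t} t+t≤n = m≤n⇒m⊓n≡m (m+n≤o⇒m≤o∸n t t+t≤n)

  geodesic-reflect : ∀ {t} → t ≤ n → geodesic (n ∸ t) ≡ geodesic t
  geodesic-reflect {t} t≤n rewrite m∸[m∸n]≡n t≤n = ⊓-comm (n ∸ t) t

  geodesic≤⌊n/2⌋ : ∀ t → geodesic t ≤ ⌊n/2⌋
  geodesic≤⌊n/2⌋ t with t ≤? ⌊n/2⌋
  ... | yes t≤ = ≤-trans (geodesic≤ t) t≤
  ... | no t≰ = ≤-trans (geodesic≤∸ t) (m≤n+o⇒m∸n≤o n t (≤-trans n≤1+⌊n/2⌋+⌊n/2⌋ (+-monoˡ-≤ ⌊n/2⌋ (≰⇒> t≰))))

  geodesic-⌊n/2⌋ : geodesic ⌊n/2⌋ ≡ ⌊n/2⌋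
  geodesic-⌊n/2⌋ = t+t≤n⇒geodesic≡t ⌊n/2⌋+⌊n/2⌋≤n

  geodesic-⌈n/2⌉ : geodesic ⌈n/2⌉ ≡ ⌊n/2⌋
  geodesic-⌈n/2⌉ = trans (geodesic-reflect ⌊n/2⌋≤n) geodesic-⌊n/2⌋

  geodesic-suc≤ : ∀ s → geodesic (suc s) ≤ suc (geodesic s)
  geodesic-suc≤ s = ⊓-mono-≤ (≤-refl {suc s}) (≤-trans (∸-monoʳ-≤ n (n≤1+n s)) (n≤1+n (n ∸ s)))

  geodesic-suc≤-long : ∀ s → n < suc s + suc s → geodesic (suc s) ≤ geodesic s
  geodesic-suc≤-long s long = ≤-trans (geodesic≤∸ (suc s))
    (⊓-glb (m≤n+o⇒m∸n≤o n (suc s) (s≤s⁻¹ (subst (n <_) (+-suc (suc s) s) long))) (∸-monoʳ-≤ n (n≤1+n s)))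

  geodesic-suc<-long : ∀ s → suc s ≤ n → suc n < suc s + suc s → geodesic (suc s) < geodesic s
  geodesic-suc<-long s s<n long = ⊓-glb <s (≤-trans (s≤s (geodesic≤∸ (suc s))) (≤-reflexive (sym n∸s≡)))
    where
    n∸s≡ : n ∸ s ≡ suc (n ∸ suc s)
    n∸s≡ = +-∸-assoc 1 s<n
    <s : suc (geodesic (suc s)) ≤ s
    <s = ≤-trans (s≤s (geodesic≤∸ (suc s)))
           (≤-trans (≤-reflexive (sym (+-∸-assoc 1 s<n)))
                    (m≤n+o⇒m∸n≤o (suc n) (suc s) (s≤s⁻¹ (subst (suc n <_) (+-suc (suc s) s) long))))

  -- Shortening every arc by one loses at most 1 on each of the first a arcs, nothing on the
  -- next c (longer than n/2), and gains at least 1 on each of the last b (longer than (n+1)/2).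
  ∑-geodesic-pred : ∀ N a c b (t : ℕ → ℕ) → a + c + b ≡ N →
    (∀ k → k < N → 1 ≤ t k × t k ≤ n) →
    (∀ k → k < N → a ≤ k → n < t k + t k) →
    (∀ k → k < N → a + c ≤ k → suc n < t k + t k) →
    ∑ N (geodesic ∘ t) + b ≤ ∑ N (λ k → geodesic (t k ∸ 1)) + a
  ∑-geodesic-pred N a c b t N≡ bounds long longer = begin
    ∑ N (geodesic ∘ t) + b                          ≡⟨ cong (∑ N (geodesic ∘ t) +_) (sym ∑loss) ⟩
    ∑ N (geodesic ∘ t) + ∑ N loss                   ≡⟨ sym (∑-distrib-+ N _ _) ⟩
    ∑ N (λ k → geodesic (t k) + loss k)             ≤⟨ ∑-mono-≤ N pointwise ⟩
    ∑ N (λ k → geodesic (t k ∸ 1) + gain k)         ≡⟨ ∑-distrib-+ N _ _ ⟩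
    ∑ N (λ k → geodesic (t k ∸ 1)) + ∑ N gain       ≡⟨ cong (∑ N (λ k → geodesic (t k ∸ 1)) +_) ∑gain ⟩
    ∑ N (λ k → geodesic (t k ∸ 1)) + a              ∎
    where
    open ≤-Reasoning
    loss gain : ℕ → ℕ
    loss k = if k <ᵇ a + c then 0 else 1
    gain k = if k <ᵇ a then 1 else 0
    ∑gain : ∑ N gain ≡ a
    ∑gain = trans (∑-truncate N a (λ _ → 1) (≤-trans (≤-trans (m≤m+n a c) (m≤m+n (a + c) b)) (≤-reflexive N≡)))
                  (trans (∑-const a 1) (*-identityʳ a))
    ∑loss : ∑ N loss ≡ b
    ∑loss = begin-equality
      ∑ N loss                                          ≡⟨ cong (λ N′ → ∑ N′ loss) (sym N≡) ⟩
      ∑ (a + c + b) loss                                ≡⟨ ∑-split (a + c) b loss ⟩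
      ∑ (a + c) loss + ∑ b (λ k → loss (a + c + k))     ≡⟨ cong₂ _+_ (∑-cong (a + c) (λ k k< → cong (λ x → if x then 0 else 1) (<ᵇ-true k<)))
                                                                     (∑-cong b (λ k _ → cong (λ x → if x then 0 else 1) (<ᵇ-false (m≤m+n (a + c) k)))) ⟩
      ∑ (a + c) (λ _ → 0) + ∑ b (λ _ → 1)               ≡⟨ cong₂ _+_ (∑-zero (a + c)) (trans (∑-const b 1) (*-identityʳ b)) ⟩
      b                                                 ∎
    pointwise : ∀ k → k < N → geodesic (t k) + loss k ≤ geodesic (t k ∸ 1) + gain k
    pointwise k k<N with t k in tk | bounds k k<N
    ... | suc s | _ , 1+s≤n with k <? a | k <? a + c
    ...   | yes k<a | _ rewrite <ᵇ-true k<a | <ᵇ-true (≤-trans k<a (m≤m+n a c)) =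
            ≤-trans (≤-reflexive (+-identityʳ _)) (≤-trans (geodesic-suc≤ s) (≤-reflexive (+-comm 1 (geodesic s))))
    ...   | no k≮a | yes k<a+c rewrite <ᵇ-false (≮⇒≥ k≮a) | <ᵇ-true k<a+c =
            +-monoˡ-≤ 0 (geodesic-suc≤-long s (subst (λ x → n < x + x) tk (long k k<N (≮⇒≥ k≮a))))
    ...   | no k≮a | no k≮a+c rewrite <ᵇ-false (≮⇒≥ k≮a) | <ᵇ-false (≮⇒≥ k≮a+c) =
            ≤-trans (≤-reflexive (+-comm (geodesic (suc s)) 1))
                    (≤-trans (geodesic-suc<-long s 1+s≤n (subst (λ x → suc n < x + x) tk (longer k k<N (≮⇒≥ k≮a+c))))
                             (≤-reflexive (sym (+-identityʳ _))))

module Enumeration (n : ℕ) (χ : ℕ → Bool) where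

  count : ℕ → ℕ
  count x = ∑ x (𝟙 ∘ χ)

  m : ℕ
  m = count n

  count-suc : ∀ {x} → χ x ≡ true → count (suc x) ≡ suc (count x)
  count-suc {x} χx rewrite χx = +-comm (count x) 1

  count-mono-≤ : ∀ {x y} → x ≤ y → count x ≤ count y
  count-mono-≤ {y = zero}  z≤n = ≤-refl
  count-mono-≤ {x} {suc y} x≤1+y with m≤n⇒m<n∨m≡n x≤1+y
  ... | inj₁ x<1+y = ≤-trans (count-mono-≤ (s≤s⁻¹ x<1+y)) (m≤m+n (count y) _)
  ... | inj₂ refl = ≤-refl

  count-mono-< : ∀ {x y} → χ x ≡ true → x < y → count x < count y
  count-mono-< χx x<y = ≤-trans (≤-reflexive (sym (count-suc χx))) (count-mono-≤ x<y)

  count-injective : ∀ {x y} → χ x ≡ true → χ y ≡ true → count x ≡ count y → x ≡ y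
  count-injective {x} {y} χx χy eq with <-cmp x y
  ... | tri< x<y _ _ = ⊥-elim (<-irrefl eq (count-mono-< χx x<y))
  ... | tri≈ _ x≡y _ = x≡y
  ... | tri> _ _ y<x = ⊥-elim (<-irrefl (sym eq) (count-mono-< χy y<x))

  count≤ : ∀ x → count x ≤ x
  count≤ zero    = z≤n
  count≤ (suc x) = ≤-trans (+-mono-≤ (count≤ x) (𝟙≤1 (χ x))) (≤-reflexive (+-comm x 1))
    where
    𝟙≤1 : ∀ b → 𝟙 b ≤ 1
    𝟙≤1 true  = ≤-refl
    𝟙≤1 false = z≤n

  m≤n : m ≤ n
  m≤n = count≤ n

  count-surjective : ∀ N i → i < count N → ∃ λ x → x < N × count x ≡ i × χ x ≡ true
  count-surjective (suc N) i i<count with i <? count N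
  ... | yes i<count′ with count-surjective N i i<count′
  ...   | x , x<N , count≡ , χx = x , m<n⇒m<1+n x<N , count≡ , χx
  count-surjective (suc N) i i<count | no i≮count with χ N in χN
  ...   | true  = N , ≤-refl , ≤-antisym (≮⇒≥ i≮count) (s≤s⁻¹ (subst (suc i ≤_) (+-comm (count N) 1) i<count)) , χN
  ...   | false = ⊥-elim (i≮count (subst (suc i ≤_) (+-identityʳ (count N)) i<count))

  -- elem i is the paper's a_i; 0 is a junk value for i ≥ m.
  abstract
    elem : ℕ → ℕ
    elem i with i <? m
    ... | yes i<m = proj₁ (count-surjective n i i<m)
    ... | no _    = 0

    elem-spec : ∀ {i} → i < m → elem i < n × count (elem i) ≡ i × χ (elem i) ≡ true
    elem-spec {i} i<m with i <? m
    ... | yes i<m′ = proj₂ (count-surjective n i i<m′)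
    ... | no i≮m   = ⊥-elim (i≮m i<m)

  elem<n : ∀ {i} → i < m → elem i < n
  elem<n i<m = proj₁ (elem-spec i<m)

  count-elem : ∀ {i} → i < m → count (elem i) ≡ i
  count-elem i<m = proj₁ (proj₂ (elem-spec i<m))

  χ-elem : ∀ {i} → i < m → χ (elem i) ≡ true
  χ-elem i<m = proj₂ (proj₂ (elem-spec i<m))

  count<m : ∀ {x} → χ x ≡ true → x < n → count x < m
  count<m = count-mono-<

  elem-count : ∀ {x} → χ x ≡ true → x < n → elem (count x) ≡ x
  elem-count χx x<n = count-injective (χ-elem (count<m χx x<n)) χx (count-elem (count<m χx x<n))

  elem-mono-< : ∀ {i j} → i < j → j < m → elem i < elem j
  elem-mono-< {i} {j} i<j j<m with elem i <? elem j
  ... | yes lt = lt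
  ... | no ≮ = ⊥-elim (<⇒≱ i<j (begin
        j                    ≡⟨ sym (count-elem j<m) ⟩
        count (elem j)       ≤⟨ count-mono-≤ (≮⇒≥ ≮) ⟩
        count (elem i)       ≡⟨ count-elem (<-trans i<j j<m) ⟩
        i                    ∎))
    where open ≤-Reasoning

  ∑-members : ∀ N → N ≤ n → (f : ℕ → ℕ) → ∑ N (λ x → if χ x then f x else 0) ≡ ∑ (count N) (f ∘ elem)
  ∑-members zero    _     f = refl
  ∑-members (suc N) 1+N≤n f with χ N in χN
  ... | true = begin
    ∑ N (λ x → if χ x then f x else 0) + f N  ≡⟨ cong₂ _+_ (∑-members N (<⇒≤ 1+N≤n) f) (cong f (sym (elem-count χN 1+N≤n))) ⟩
    ∑ (suc (count N)) (f ∘ elem)              ≡⟨ cong (λ k → ∑ k (f ∘ elem)) (+-comm 1 (count N)) ⟩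
    ∑ (count N + 1) (f ∘ elem)                ∎
    where open ≡-Reasoning
  ... | false = trans (+-identityʳ _) (trans (∑-members N (<⇒≤ 1+N≤n) f) (cong (λ k → ∑ k (f ∘ elem)) (sym (+-identityʳ (count N)))))

  concat-members : ∀ {A : Set} N → N ≤ n → (g : ℕ → List A) (f : ℕ → A) →
                   (∀ x → x < n → g x ≡ (if χ x then [ f x ] else [])) →
                   concat (applyUpTo g N) ≡ applyUpTo (f ∘ elem) (count N)
  concat-members zero    _     g f g≗ = refl
  concat-members (suc N) 1+N≤n g f g≗ = begin
    concat (applyUpTo g (suc N))                       ≡⟨ cong concat (sym (applyUpTo-∷ʳ g N)) ⟩
    concat (applyUpTo g N ++ [ g N ])                  ≡⟨ sym (concat-++ (applyUpTo g N) [ g N ]) ⟩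
    concat (applyUpTo g N) ++ g N ++ []                ≡⟨ cong₂ _++_ (concat-members N (<⇒≤ 1+N≤n) g f g≗) (++-identityʳ (g N)) ⟩
    applyUpTo (f ∘ elem) (count N) ++ g N              ≡⟨ last (χ N) refl ⟩
    applyUpTo (f ∘ elem) (count N + 𝟙 (χ N))           ∎
    where
    open ≡-Reasoning
    last : ∀ b → χ N ≡ b → applyUpTo (f ∘ elem) (count N) ++ g N ≡ applyUpTo (f ∘ elem) (count N + 𝟙 b)
    last true χN = begin
      applyUpTo (f ∘ elem) (count N) ++ g N                 ≡⟨ cong (applyUpTo (f ∘ elem) (count N) ++_) (trans (g≗ N 1+N≤n) (cong (λ b → if b then [ f N ] else []) χN)) ⟩
      applyUpTo (f ∘ elem) (count N) ++ [ f N ]             ≡⟨ cong (λ x → applyUpTo (f ∘ elem) (count N) ++ [ f x ]) (sym (elem-count χN 1+N≤n)) ⟩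
      applyUpTo (f ∘ elem) (count N) ++ [ f (elem (count N)) ] ≡⟨ applyUpTo-∷ʳ (f ∘ elem) (count N) ⟩
      applyUpTo (f ∘ elem) (suc (count N))                  ≡⟨ cong (applyUpTo (f ∘ elem)) (+-comm 1 (count N)) ⟩
      applyUpTo (f ∘ elem) (count N + 1)                    ∎
    last false χN = trans (cong (applyUpTo (f ∘ elem) (count N) ++_) (trans (g≗ N 1+N≤n) (cong (λ b → if b then [ f N ] else []) χN)))
                          (trans (++-identityʳ _) (cong (applyUpTo (f ∘ elem)) (sym (+-identityʳ (count N)))))

  module Unrolled (m>0 : 0 < m) where

    instance
      m≢0 : NonZero m
      m≢0 = >-nonZero m>0
      n≢0 : NonZero n
      n≢0 = >-nonZero (≤-trans m>0 m≤n)

    -- a_i lifted to the universal cover ℕ of C_n and extended to all i by a_{i+m} = a_i + n.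
    unroll : ℕ → ℕ
    unroll j = elem (j % m) + (j / m) * n

    elem% : ℕ → ℕ
    elem% j = elem (j % m)

    elem%<n : ∀ j → elem% j < n
    elem%<n j = elem<n (m%n<n j m)

    χ-elem% : ∀ j → χ (elem% j) ≡ true
    χ-elem% j = χ-elem (m%n<n j m)

    elem%≡elem : ∀ {i} → i < m → elem% i ≡ elem i
    elem%≡elem i<m = cong elem (m<n⇒m%n≡m i<m)

    elem%-+m : ∀ j → elem% (j + m) ≡ elem% j
    elem%-+m j = cong elem ([m+n]%n≡m%n j m)

    unroll≡elem : ∀ {i} → i < m → unroll i ≡ elem i
    unroll≡elem {i} i<m rewrite m<n⇒m%n≡m i<m | m<n⇒m/n≡0 i<m = +-identityʳ (elem i)

    unroll-%n : ∀ j → unroll j % n ≡ elem% j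
    unroll-%n j = trans ([m+kn]%n≡m%n (elem% j) (j / m) n) (m<n⇒m%n≡m (elem%<n j))

    unroll-+m : ∀ j → unroll (j + m) ≡ unroll j + n
    unroll-+m j = begin
      elem% (j + m) + ((j + m) / m) * n    ≡⟨ cong₂ (λ x q → x + q * n) (elem%-+m j) ([m+n]/n≡1+m/n j m) ⟩
      elem% j + (n + (j / m) * n)          ≡⟨ cong (elem% j +_) (+-comm n ((j / m) * n)) ⟩
      elem% j + ((j / m) * n + n)          ≡⟨ sym (+-assoc (elem% j) ((j / m) * n) n) ⟩
      unroll j + n                         ∎
      where open ≡-Reasoning

    unroll-+q*m : ∀ q x → unroll (x + q * m) ≡ unroll x + q * n
    unroll-+q*m zero    x = trans (cong unroll (+-identityʳ x)) (sym (+-identityʳ (unroll x)))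
    unroll-+q*m (suc q) x = begin
      unroll (x + (m + q * m))    ≡⟨ cong unroll (trans (cong (x +_) (+-comm m (q * m))) (sym (+-assoc x (q * m) m))) ⟩
      unroll (x + q * m + m)      ≡⟨ unroll-+m (x + q * m) ⟩
      unroll (x + q * m) + n      ≡⟨ cong (_+ n) (unroll-+q*m q x) ⟩
      unroll x + q * n + n        ≡⟨ trans (+-assoc (unroll x) (q * n) n) (cong (unroll x +_) (+-comm (q * n) n)) ⟩
      unroll x + (n + q * n)      ∎
      where open ≡-Reasoning

    unroll-% : ∀ j x → unroll (j + x) ≡ unroll (j % m + x) + (j / m) * n
    unroll-% j x = trans (cong (λ y → unroll (y + x)) (m≡m%n+[m/n]*n j m))
                         (trans (cong unroll (+-right-comm (j % m) ((j / m) * m) x)) (unroll-+q*m (j / m) (j % m + x)))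
      where
      +-right-comm : ∀ a b c → a + b + c ≡ a + c + b
      +-right-comm = solve-∀

    unroll-%₀ : ∀ j → unroll j ≡ unroll (j % m) + (j / m) * n
    unroll-%₀ j = trans (cong unroll (sym (+-identityʳ j)))
                        (trans (unroll-% j 0) (cong (λ y → unroll y + (j / m) * n) (+-identityʳ (j % m))))

    unroll-<-suc : ∀ j → unroll j < unroll (suc j)
    unroll-<-suc j = begin-strict
      unroll j                                   ≡⟨ unroll-%₀ j ⟩
      unroll (j % m) + (j / m) * n               <⟨ +-monoˡ-< ((j / m) * n) (within-period (m%n<n j m)) ⟩
      unroll (j % m + 1) + (j / m) * n           ≡⟨ sym (unroll-% j 1) ⟩
      unroll (j + 1)                             ≡⟨ cong unroll (+-comm j 1) ⟩
      unroll (suc j)                             ∎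
      where
      open ≤-Reasoning
      within-period : ∀ {r} → r < m → unroll r < unroll (r + 1)
      within-period {r} r<m with r + 1 <? m
      ... | yes r+1<m rewrite unroll≡elem r<m | unroll≡elem r+1<m = elem-mono-< (m<m+n r z<s) r+1<m
      ... | no r+1≮m = begin-strict
        unroll r              ≡⟨ unroll≡elem r<m ⟩
        elem r                <⟨ elem<n r<m ⟩
        n                     ≤⟨ m≤n+m n (unroll 0) ⟩
        unroll 0 + n          ≡⟨ sym (unroll-+m 0) ⟩
        unroll m              ≡⟨ cong unroll (≤-antisym (≮⇒≥ r+1≮m) (≤-trans (≤-reflexive (+-comm r 1)) r<m)) ⟩
        unroll (r + 1)        ∎

    unroll-+-≥ : ∀ i j → unroll i + j ≤ unroll (i + j)
    unroll-+-≥ i zero    rewrite +-identityʳ i | +-identityʳ (unroll i) = ≤-refl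
    unroll-+-≥ i (suc j) rewrite +-suc (unroll i) j | +-suc i j = ≤-trans (s≤s (unroll-+-≥ i j)) (unroll-<-suc (i + j))

    unroll-mono-≤ : ∀ {i j} → i ≤ j → unroll i ≤ unroll j
    unroll-mono-≤ {i} i≤j with m≤n⇒∃[o]m+o≡n i≤j
    ... | o , refl = ≤-trans (m≤m+n (unroll i) o) (unroll-+-≥ i o)

    unroll-mono-< : ∀ {i j} → i < j → unroll i < unroll j
    unroll-mono-< {i} i<j = ≤-trans (unroll-<-suc i) (unroll-mono-≤ i<j)

    unroll-+≤ : ∀ i {k} → k ≤ m → unroll (i + k) ≤ unroll i + n
    unroll-+≤ i k≤m = ≤-trans (unroll-mono-≤ (+-monoʳ-≤ i k≤m)) (≤-reflexive (unroll-+m i))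

    unroll-+< : ∀ i {k} → k < m → unroll (i + k) < unroll i + n
    unroll-+< i k<m = ≤-trans (unroll-mono-< (+-monoʳ-< i k<m)) (≤-reflexive (unroll-+m i))

    arc : ℕ → ℕ → ℕ
    arc k i = unroll (i + k) ∸ unroll i

    arc+unroll : ∀ k i → arc k i + unroll i ≡ unroll (i + k)
    arc+unroll k i = m∸n+n≡m (unroll-mono-≤ (m≤m+n i k))

    ∑-arc : ∀ k → ∑ m (arc k) ≡ k * n
    ∑-arc k = +-cancelʳ-≡ (∑ m unroll) _ _ (begin
      ∑ m (arc k) + ∑ m unroll               ≡⟨ sym (∑-distrib-+ m (arc k) unroll) ⟩
      ∑ m (λ i → arc k i + unroll i)         ≡⟨ ∑-cong m (λ i _ → arc+unroll k i) ⟩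
      ∑ m (λ i → unroll (i + k))             ≡⟨ ∑-translate m n unroll unroll-+m k ⟩
      ∑ m unroll + k * n                     ≡⟨ +-comm (∑ m unroll) (k * n) ⟩
      k * n + ∑ m unroll                     ∎)
      where open ≡-Reasoning

    arc≤n : ∀ k i → k ≤ m → arc k i ≤ n
    arc≤n k i k≤m = m≤n+o⇒m∸n≤o (unroll (i + k)) (unroll i) (unroll-+≤ i k≤m)

    arc-mono-≤ : ∀ {k l} i → k ≤ l → arc k i ≤ arc l i
    arc-mono-≤ i k≤l = ∸-monoˡ-≤ (unroll i) (unroll-mono-≤ (+-monoʳ-≤ i k≤l))

    arc-mono-< : ∀ {k l} i → k < l → arc k i < arc l i
    arc-mono-< {k} i k<l = ∸-monoˡ-< (unroll-mono-< (+-monoʳ-< i k<l)) (unroll-mono-≤ (m≤m+n i k))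

    1≤arc : ∀ k i → 1 ≤ k → 1 ≤ arc k i
    1≤arc k i 1≤k = ≤-trans (s≤s z≤n) (arc-mono-< {0} i 1≤k)

    arc-+m : ∀ k i → arc k (i + m) ≡ arc k i
    arc-+m k i = trans (cong₂ _∸_ (trans (cong unroll (+-right-comm i m k)) (unroll-+m (i + k))) (unroll-+m i))
                       ([m+o]∸[n+o]≡m∸n (unroll (i + k)) (unroll i) n)
      where
      +-right-comm : ∀ a b c → a + b + c ≡ a + c + b
      +-right-comm = solve-∀

    arc-% : ∀ k j → arc k j ≡ arc k (j % m)
    arc-% k j = trans (cong₂ _∸_ (unroll-% j k) (unroll-%₀ j))
                      ([m+o]∸[n+o]≡m∸n (unroll (j % m + k)) (unroll (j % m)) ((j / m) * n))

    arc-complement : ∀ k i → k ≤ m → arc (m ∸ k) (i + k) ≡ n ∸ arc k i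
    arc-complement k i k≤m = begin
      unroll (i + k + (m ∸ k)) ∸ unroll (i + k)   ≡⟨ cong (λ j → unroll j ∸ unroll (i + k)) (trans (+-assoc i k (m ∸ k)) (cong (i +_) (m+[n∸m]≡n k≤m))) ⟩
      unroll (i + m) ∸ unroll (i + k)             ≡⟨ cong (_∸ unroll (i + k)) (unroll-+m i) ⟩
      (unroll i + n) ∸ unroll (i + k)             ≡⟨ Cycle.[a+n]∸b≡n∸[b∸a] n (unroll-mono-≤ (m≤m+n i k)) ⟩
      n ∸ arc k i                                 ∎
      where open ≡-Reasoning

    HoleAfter : ℕ → Set
    HoleAfter j = 2 + unroll j ≤ unroll (suc j)

    HoleAfter-% : ∀ j → HoleAfter j → HoleAfter (j % m)
    HoleAfter-% j hole = +-cancelʳ-≤ ((j / m) * n) _ _ (subst₂ _≤_ (cong (2 +_) (unroll-%₀ j)) next hole)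
      where
      next : unroll (suc j) ≡ unroll (suc (j % m)) + (j / m) * n
      next = trans (cong unroll (+-comm 1 j)) (trans (unroll-% j 1) (cong (λ y → unroll y + (j / m) * n) (+-comm (j % m) 1)))

    arc-≤-next : ∀ r x → unroll (suc x) ≡ suc (unroll x) → arc r x ≤ arc r (suc x)
    arc-≤-next r x flat = begin
      suc (unroll (x + r)) ∸ suc (unroll x)   ≤⟨ ∸-monoˡ-≤ (suc (unroll x)) (unroll-<-suc (x + r)) ⟩
      unroll (suc x + r) ∸ suc (unroll x)     ≡⟨ cong (unroll (suc x + r) ∸_) (sym flat) ⟩
      unroll (suc x + r) ∸ unroll (suc x)     ∎
      where open ≤-Reasoning

    -- Without holes after a_j, …, a_{j+r-1} the arc of span r at j would be exactly r.
    long-arc⇒hole : ∀ r {len} j → r < len → len ≤ arc r j → ∃ λ x → len ≤ arc r x × HoleAfter x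
    long-arc⇒hole r {len} j r<len long with walk r ≤-refl
      where
      walk : ∀ s → s ≤ r → (∃ λ x → len ≤ arc r x × HoleAfter x) ⊎ (len ≤ arc r (j + s) × unroll (j + s) ≡ unroll j + s)
      walk zero _ = inj₂ (subst (λ x → len ≤ arc r x) (sym (+-identityʳ j)) long , trans (cong unroll (+-identityʳ j)) (sym (+-identityʳ _)))
      walk (suc s) s<r with walk s (<⇒≤ s<r)
      ... | inj₁ found = inj₁ found
      ... | inj₂ (long′ , flat) with unroll (suc (j + s)) ≤? suc (unroll (j + s))
      ...   | no hole = inj₁ (j + s , long′ , ≰⇒> hole)
      ...   | yes no-hole = inj₂ ( subst (λ x → len ≤ arc r x) (sym (+-suc j s)) (≤-trans long′ (arc-≤-next r (j + s) step))
                           , trans (cong unroll (+-suc j s)) (trans step (trans (cong suc flat) (sym (+-suc (unroll j) s)))))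
        where
        step : unroll (suc (j + s)) ≡ suc (unroll (j + s))
        step = ≤-antisym no-hole (unroll-<-suc (j + s))
    ... | inj₁ found = found
    ... | inj₂ (_ , flat) = ⊥-elim (<⇒≱ r<len (≤-trans long (≤-reflexive (trans (cong (_∸ unroll j) flat) (m+n∸m≡n (unroll j) r)))))

module TotalDistance (n : ℕ) where
  open Cycle n

  potential : (ℕ → Bool) → ℕ → ℕ
  potential Z w = ∑ n (λ y → if Z y then distℕ w y else 0)

  -- Q Z is 2 W(Z): every unordered pair is counted in both orders.
  Q : (ℕ → Bool) → ℕ
  Q Z = ∑ n (λ x → if Z x then potential Z x else 0)

  Q-cong : ∀ {Z Z′} → (∀ x → Z x ≡ Z′ x) → Q Z ≡ Q Z′
  Q-cong {Z} {Z′} Z≗Z′ = ∑-cong n (λ x _ → cong₂ (λ b p → if b then p else 0) (Z≗Z′ x)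
                           (∑-cong n (λ y _ → cong (λ b → if b then distℕ x y else 0) (Z≗Z′ y))))

  Q-insert : ∀ (Y : ℕ → Bool) w → w < n → Y w ≡ false →
             Q (λ x → Y x ∨ (x ≡ᵇ w)) ≡ Q Y + potential Y w + potential Y w
  Q-insert Y w w<n Yw≡false = begin
    Q Y+w                                                                     ≡⟨ ∑-cong n (λ x _ → cong (λ p → if Y+w x then p else 0) (∑-insert n Y w w<n Yw≡false (distℕ x))) ⟩
    ∑ n (λ x → if Y+w x then potential Y x + distℕ x w else 0)                ≡⟨ ∑-insert n Y w w<n Yw≡false _ ⟩
    ∑ n (λ x → if Y x then potential Y x + distℕ x w else 0) + (potential Y w + distℕ w w)
      ≡⟨ cong₂ _+_ (trans (∑-cong n (λ x _ → if-+ (Y x) _ _)) (∑-distrib-+ n _ _)) (cong (potential Y w +_) (distℕ-refl w)) ⟩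
    Q Y + ∑ n (λ x → if Y x then distℕ x w else 0) + (potential Y w + 0)      ≡⟨ cong₂ _+_ (cong (Q Y +_) (∑-cong n (λ x _ → cong (λ d → if Y x then d else 0) (distℕ-sym x w)))) (+-identityʳ _) ⟩
    Q Y + potential Y w + potential Y w                                       ∎
    where
    open ≡-Reasoning
    Y+w : ℕ → Bool
    Y+w x = Y x ∨ (x ≡ᵇ w)

infix 7 _∈ᵇ_

_∈ᵇ_ : ∀ {n} → ℕ → Subset n → Bool
_     ∈ᵇ []      = false
zero  ∈ᵇ (b ∷ A) = b
suc x ∈ᵇ (b ∷ A) = x ∈ᵇ A

lookup≡∈ᵇ : ∀ {n} (A : Subset n) u → lookup A u ≡ toℕ u ∈ᵇ A
lookup≡∈ᵇ (b ∷ A) Fin.zero    = refl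
lookup≡∈ᵇ (b ∷ A) (Fin.suc u) = lookup≡∈ᵇ A u

∈⇒∈ᵇ : ∀ {n} {A : Subset n} {u} → u ∈ A → toℕ u ∈ᵇ A ≡ true
∈⇒∈ᵇ {A = A} {u} u∈A = trans (sym (lookup≡∈ᵇ A u)) ([]=⇒lookup u∈A)

∈ᵇ⇒∈ : ∀ {n} {A : Subset n} {u} → toℕ u ∈ᵇ A ≡ true → u ∈ A
∈ᵇ⇒∈ {A = A} {u} eq = lookup⇒[]= u A (trans (lookup≡∈ᵇ A u) eq)

∉⇒∈ᵇ : ∀ {n} {A : Subset n} {u} → u ∉ A → toℕ u ∈ᵇ A ≡ false
∉⇒∈ᵇ {A = A} {u} u∉A with toℕ u ∈ᵇ A in eq
... | true  = ⊥-elim (u∉A (∈ᵇ⇒∈ eq))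
... | false = refl

∣∣≡∑∈ᵇ : ∀ {n} (A : Subset n) → ∣ A ∣ ≡ ∑ n (λ x → 𝟙 (x ∈ᵇ A))
∣∣≡∑∈ᵇ []              = refl
∣∣≡∑∈ᵇ {suc n} (true ∷ A)  = trans (cong suc (∣∣≡∑∈ᵇ A)) (sym (∑-head n (λ x → 𝟙 (x ∈ᵇ (true ∷ A)))))
∣∣≡∑∈ᵇ {suc n} (false ∷ A) = trans (∣∣≡∑∈ᵇ A) (sym (∑-head n (λ x → 𝟙 (x ∈ᵇ (false ∷ A)))))

∈ᵇ-∅ : ∀ {n} x → x ∈ᵇ ∅ {n} ≡ false
∈ᵇ-∅ {zero}  x       = refl
∈ᵇ-∅ {suc n} zero    = refl
∈ᵇ-∅ {suc n} (suc x) = ∈ᵇ-∅ {n} x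

∈ᵇ-∪ : ∀ {n} (A B : Subset n) x → x ∈ᵇ (A ∪ B) ≡ (x ∈ᵇ A ∨ x ∈ᵇ B)
∈ᵇ-∪ []      []      x       = refl
∈ᵇ-∪ (a ∷ A) (b ∷ B) zero    = refl
∈ᵇ-∪ (a ∷ A) (b ∷ B) (suc x) = ∈ᵇ-∪ A B x

∈ᵇ-─ : ∀ {n} (A B : Subset n) x → x ∈ᵇ (A ─ B) ≡ (x ∈ᵇ A ∧ not (x ∈ᵇ B))
∈ᵇ-─ []          []          x       = refl
∈ᵇ-─ (true ∷ A)  (true ∷ B)  zero    = refl
∈ᵇ-─ (true ∷ A)  (false ∷ B) zero    = refl
∈ᵇ-─ (false ∷ A) (true ∷ B)  zero    = refl
∈ᵇ-─ (false ∷ A) (false ∷ B) zero    = refl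
∈ᵇ-─ (a ∷ A)     (b ∷ B)     (suc x) = ∈ᵇ-─ A B x

∈ᵇ-⁅⁆ : ∀ {n} (u : Fin n) x → x ∈ᵇ ⁅ u ⁆ ≡ (x ≡ᵇ toℕ u)
∈ᵇ-⁅⁆         Fin.zero    zero    = refl
∈ᵇ-⁅⁆ {suc n} Fin.zero    (suc x) = ∈ᵇ-∅ {n} x
∈ᵇ-⁅⁆         (Fin.suc u) zero    = refl
∈ᵇ-⁅⁆         (Fin.suc u) (suc x) = ∈ᵇ-⁅⁆ u x

∈ᵇ-exchange : ∀ {n} (A : Subset n) u v x →
              x ∈ᵇ ((A ─ ⁅ u ⁆) ∪ ⁅ v ⁆) ≡ ((x ∈ᵇ A ∧ not (x ≡ᵇ toℕ u)) ∨ (x ≡ᵇ toℕ v))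
∈ᵇ-exchange A u v x rewrite ∈ᵇ-∪ (A ─ ⁅ u ⁆) ⁅ v ⁆ x | ∈ᵇ-─ A ⁅ u ⁆ x | ∈ᵇ-⁅⁆ u x | ∈ᵇ-⁅⁆ v x = refl

∈ᵇ-remove-insert : ∀ {n} (A : Subset n) w → w ∈ᵇ A ≡ true → ∀ x → x ∈ᵇ A ≡ ((x ∈ᵇ A ∧ not (x ≡ᵇ w)) ∨ (x ≡ᵇ w))
∈ᵇ-remove-insert A w w∈A x with x ∈ᵇ A in x∈A | x ≡ᵇ w in x≡ᵇw
... | true  | true  = refl
... | true  | false = refl
... | false | true  = ⊥-elim (false≢true (trans (sym x∈A) (trans (cong (_∈ᵇ A) (≡ᵇ-true⁻ x≡ᵇw)) w∈A)))
  where
  false≢true : false ≢ true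
  false≢true ()
... | false | false = refl

∉-removed : ∀ {n} (A : Subset n) u x → x ∈ᵇ A ≡ false → (x ∈ᵇ A ∧ not (x ≡ᵇ u)) ≡ false
∉-removed A u x x∉A rewrite x∉A = refl

removed-∉ : ∀ {n} (A : Subset n) u → (u ∈ᵇ A ∧ not (u ≡ᵇ u)) ≡ false
removed-∉ A u rewrite ≡ᵇ-true u with u ∈ᵇ A
... | true  = refl
... | false = refl

sum-map-allFin : ∀ {n} (f : Fin n → ℕ) (g : ℕ → ℕ) → (∀ u → f u ≡ g (toℕ u)) → sum (map f (allFin n)) ≡ ∑ n g
sum-map-allFin {n} f g f≗g = trans (cong sum (map-allFin n f g f≗g)) (sum-applyUpTo n g)

sum-concatMap-allFin : ∀ {n} (f : Fin n → Fin n → ℕ) (g : ℕ → ℕ → ℕ) → (∀ u v → f u v ≡ g (toℕ u) (toℕ v)) →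
  sum (concatMap (λ u → map (f u) (allFin n)) (allFin n)) ≡ ∑ n (λ x → ∑ n (g x))
sum-concatMap-allFin {n} f g f≗g = begin
  sum (concat (map (λ u → map (f u) (allFin n)) (allFin n)))   ≡⟨ sum-concat (map (λ u → map (f u) (allFin n)) (allFin n)) ⟩
  sum (map sum (map (λ u → map (f u) (allFin n)) (allFin n)))  ≡⟨ cong sum (sym (map-∘ (allFin n))) ⟩
  sum (map (λ u → sum (map (f u) (allFin n))) (allFin n))      ≡⟨ sum-map-allFin _ (λ x → ∑ n (g x)) (λ u → sum-map-allFin (f u) (g (toℕ u)) (f≗g u)) ⟩
  ∑ n (λ x → ∑ n (g x))                                         ∎
  where open ≡-Reasoning

concatMap-allFin : ∀ {n} (f : Fin n → Fin n → List ℕ) (g : ℕ → ℕ → List ℕ) → (∀ u v → f u v ≡ g (toℕ u) (toℕ v)) →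
  concatMap (λ u → concatMap (f u) (allFin n)) (allFin n) ≡ concat (applyUpTo (λ x → concat (applyUpTo (g x) n)) n)
concatMap-allFin {n} f g f≗g = cong concat (map-allFin n _ _ (λ u → cong concat (map-allFin n (f u) (g (toℕ u)) (f≗g u))))

W+W≡Q : ∀ {n} (A : Subset n) → W A + W A ≡ TotalDistance.Q n (_∈ᵇ A)
W+W≡Q {n} A = begin
  W A + W A                                              ≡⟨ cong₂ _+_ W≡ W≡ ⟩
  ∑∑ upper + ∑∑ upper                                    ≡⟨ cong (∑∑ upper +_) (trans (∑-comm n n upper) (∑-cong n (λ x _ → ∑-cong n (λ y _ → upper≡lower y x)))) ⟩
  ∑∑ upper + ∑∑ lower                                    ≡⟨ sym (∑-distrib-+ n _ _) ⟩
  ∑ n (λ x → ∑ n (upper x) + ∑ n (lower x))             ≡⟨ ∑-cong n (λ x _ → trans (sym (∑-distrib-+ n _ _)) (∑-cong n (λ y _ → sym (split x y)))) ⟩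
  ∑ n (λ x → ∑ n (λ y → if x ∈ᵇ A then (if y ∈ᵇ A then distℕ x y else 0) else 0))
                                                          ≡⟨ ∑-cong n (λ x _ → ∑-if n (x ∈ᵇ A) _) ⟩
  TotalDistance.Q n (_∈ᵇ A)                                      ∎
  where
  open ≡-Reasoning
  open Cycle n
  ∑∑ : (ℕ → ℕ → ℕ) → ℕ
  ∑∑ f = ∑ n (λ x → ∑ n (f x))
  upper lower : ℕ → ℕ → ℕ
  upper x y = if x ∈ᵇ A ∧ y ∈ᵇ A ∧ (x <ᵇ y) then distℕ x y else 0
  lower x y = if y ∈ᵇ A ∧ x ∈ᵇ A ∧ (y <ᵇ x) then distℕ x y else 0
  W≡ : W A ≡ ∑∑ upper
  W≡ = sum-concatMap-allFin _ upper entry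
    where
    entry : ∀ u v → (if inA A u ∧ inA A v ∧ (toℕ u <ᵇ toℕ v) then dist u v else 0) ≡ upper (toℕ u) (toℕ v)
    entry u v rewrite lookup≡∈ᵇ A u | lookup≡∈ᵇ A v = refl
  upper≡lower : ∀ x y → upper x y ≡ lower y x
  upper≡lower x y = cong (λ d → if x ∈ᵇ A ∧ y ∈ᵇ A ∧ (x <ᵇ y) then d else 0) (distℕ-sym x y)
  split : ∀ x y → (if x ∈ᵇ A then (if y ∈ᵇ A then distℕ x y else 0) else 0) ≡ upper x y + lower x y
  split x y with x ∈ᵇ A | y ∈ᵇ A
  ... | false | false = refl
  ... | false | true  = refl
  ... | true  | false = refl
  ... | true  | true  with <-cmp x y
  ...   | tri< x<y _ _ rewrite <ᵇ-true x<y | <ᵇ-false {y} {x} (<⇒≤ x<y) = sym (+-identityʳ _)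
  ...   | tri≈ _ refl _ rewrite <ᵇ-false {x} {x} ≤-refl | distℕ-refl x = refl
  ...   | tri> _ _ y<x rewrite <ᵇ-true y<x | <ᵇ-false {x} {y} (<⇒≤ y<x) = refl

module Exchange {n} (A : Subset n) {u v : Fin n} (u∈A : u ∈ A) (v∉A : v ∉ A) where
  open Cycle n
  open TotalDistance n

  Y : ℕ → Bool
  Y x = x ∈ᵇ A ∧ not (x ≡ᵇ toℕ u)

  B : Subset n
  B = (A ─ ⁅ u ⁆) ∪ ⁅ v ⁆

  private
    A≗Y+u : ∀ x → x ∈ᵇ A ≡ (Y x ∨ (x ≡ᵇ toℕ u))
    A≗Y+u = ∈ᵇ-remove-insert A (toℕ u) (∈⇒∈ᵇ u∈A)

    Yv≡false : Y (toℕ v) ≡ false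
    Yv≡false = ∉-removed A (toℕ u) (toℕ v) (∉⇒∈ᵇ v∉A)

    Yu≡false : Y (toℕ u) ≡ false
    Yu≡false = removed-∉ A (toℕ u)

  ∣B∣≡∣A∣ : ∣ B ∣ ≡ ∣ A ∣
  ∣B∣≡∣A∣ = begin
    ∣ B ∣                                          ≡⟨ ∣∣≡∑∈ᵇ B ⟩
    ∑ n (λ x → 𝟙 (x ∈ᵇ B))                         ≡⟨ ∑-cong n (λ x _ → cong 𝟙 (∈ᵇ-exchange A u v x)) ⟩
    ∑ n (λ x → 𝟙 (Y x ∨ (x ≡ᵇ toℕ v)))             ≡⟨ ∑-insert n Y (toℕ v) (toℕ<n v) Yv≡false (λ _ → 1) ⟩
    ∑ n (λ x → 𝟙 (Y x)) + 1                        ≡⟨ sym (∑-insert n Y (toℕ u) (toℕ<n u) Yu≡false (λ _ → 1)) ⟩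
    ∑ n (λ x → 𝟙 (Y x ∨ (x ≡ᵇ toℕ u)))             ≡⟨ ∑-cong n (λ x _ → cong 𝟙 (sym (A≗Y+u x))) ⟩
    ∑ n (λ x → 𝟙 (x ∈ᵇ A))                         ≡⟨ sym (∣∣≡∑∈ᵇ A) ⟩
    ∣ A ∣                                          ∎
    where open ≡-Reasoning

  W-exchange : W B + potential Y (toℕ u) ≡ W A + potential Y (toℕ v)
  W-exchange = *-cancelˡ-≡ _ _ 2 (begin
    2 * (W B + Ru)                  ≡⟨ double (W B + Ru) ⟩
    W B + Ru + (W B + Ru)           ≡⟨ +-interchange (W B) Ru (W B) Ru ⟩
    (W B + W B) + (Ru + Ru)         ≡⟨ cong (_+ (Ru + Ru)) WB+WB ⟩
    Q Y + Rv + Rv + (Ru + Ru)       ≡⟨ rearrange (Q Y) Rv Ru ⟩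
    Q Y + Ru + Ru + (Rv + Rv)       ≡⟨ cong (_+ (Rv + Rv)) (sym WA+WA) ⟩
    (W A + W A) + (Rv + Rv)         ≡⟨ sym (+-interchange (W A) Rv (W A) Rv) ⟩
    W A + Rv + (W A + Rv)           ≡⟨ sym (double (W A + Rv)) ⟩
    2 * (W A + Rv)                  ∎)
    where
    open ≡-Reasoning
    Ru = potential Y (toℕ u)
    Rv = potential Y (toℕ v)
    double : ∀ x → 2 * x ≡ x + x
    double x = cong (x +_) (+-identityʳ x)
    +-interchange : ∀ a b c d → a + b + (c + d) ≡ a + c + (b + d)
    +-interchange = solve-∀
    rearrange : ∀ q r s → q + r + r + (s + s) ≡ q + s + s + (r + r)
    rearrange = solve-∀
    WB+WB : W B + W B ≡ Q Y + Rv + Rv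
    WB+WB = trans (W+W≡Q B) (trans (Q-cong (∈ᵇ-exchange A u v)) (Q-insert Y (toℕ v) (toℕ<n v) Yv≡false))
    WA+WA : W A + W A ≡ Q Y + Ru + Ru
    WA+WA = trans (W+W≡Q A) (trans (Q-cong A≗Y+u) (Q-insert Y (toℕ u) (toℕ<n u) Yu≡false))

max⇒local : ∀ {n} (A : Subset n) → Maximizer A → LocalMaximizer A
max⇒local A max _ (u , v , u∈A , v∉A , _ , refl) = max ((A ─ ⁅ u ⁆) ∪ ⁅ v ⁆) (Exchange.∣B∣≡∣A∣ A u∈A v∉A)

module OnSubset {n : ℕ} (A : Subset n) where
  open Cycle n
  open TotalDistance n
  open Enumeration n (_∈ᵇ A) public

  ∣A∣≡m : ∣ A ∣ ≡ m
  ∣A∣≡m = ∣∣≡∑∈ᵇ A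

  rank≡count : ∀ u → rank A u ≡ count (toℕ u)
  rank≡count u = trans (sum-map-allFin _ (λ w → if w ∈ᵇ A ∧ (w <ᵇ toℕ u) then 1 else 0) entry)
                       (trans (∑-cong n (λ w _ → reorder w)) (∑-truncate n (toℕ u) _ (<⇒≤ (toℕ<n u))))
    where
    entry : ∀ w → (if inA A w ∧ (toℕ w <ᵇ toℕ u) then 1 else 0) ≡ (if toℕ w ∈ᵇ A ∧ (toℕ w <ᵇ toℕ u) then 1 else 0)
    entry w rewrite lookup≡∈ᵇ A w = refl
    reorder : ∀ w → (if w ∈ᵇ A ∧ (w <ᵇ toℕ u) then 1 else 0) ≡ (if w <ᵇ toℕ u then 𝟙 (w ∈ᵇ A) else 0)
    reorder w with w ∈ᵇ A | w <ᵇ toℕ u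
    ... | true  | true  = refl
    ... | true  | false = refl
    ... | false | true  = refl
    ... | false | false = refl

  spanℕ : ℕ → ℕ → ℕ
  spanℕ i j = if i <ᵇ j then j ∸ i else (m + j) ∸ i

  spanA≡spanℕ : ∀ u v → spanA A u v ≡ spanℕ (count (toℕ u)) (count (toℕ v))
  spanA≡spanℕ u v rewrite rank≡count u | rank≡count v | ∣A∣≡m = refl

  InSpan : ℕ → ℕ → ℕ → Bool
  InSpan k x y = x ∈ᵇ A ∧ y ∈ᵇ A ∧ not (x ≡ᵇ y) ∧ (spanℕ (count x) (count y) ≡ᵇ k)

  sigmaWith≡ : ∀ (f : Fin n → Fin n → ℕ) (g : ℕ → ℕ → ℕ) → (∀ u v → f u v ≡ g (toℕ u) (toℕ v)) → ∀ k →
    sigmaWith f A k ≡ concat (applyUpTo (λ x → concat (applyUpTo (λ y → if InSpan k x y then [ g x y ] else []) n)) n)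
  sigmaWith≡ f g f≗g k = concatMap-allFin _ _ entry
    where
    entry : ∀ u v → (if inA A u ∧ inA A v ∧ not (toℕ u ≡ᵇ toℕ v) ∧ (spanA A u v ≡ᵇ k) then [ f u v ] else [])
                    ≡ (if InSpan k (toℕ u) (toℕ v) then [ g (toℕ u) (toℕ v) ] else [])
    entry u v rewrite lookup≡∈ᵇ A u | lookup≡∈ᵇ A v | spanA≡spanℕ u v | f≗g u v = refl

  module Positive (m>0 : 0 < m) where
    open Unrolled m>0 public

    m-1 : ℕ
    m-1 = m ∸ 1

    1+m-1≡m : suc m-1 ≡ m
    1+m-1≡m = trans (+-comm 1 m-1) (m∸n+n≡m m>0)

    1+k<m : ∀ {k} → k < m-1 → suc k < m
    1+k<m k<m-1 = subst (suc _ <_) 1+m-1≡m (s≤s k<m-1)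

    spanℕ⇒partner : ∀ {i j k} → i < m → j < m → spanℕ i j ≡ k → j ≡ (i + k) % m
    spanℕ⇒partner {i} {j} {k} i<m j<m span≡k with i <ᵇ j in i<ᵇj
    ... | true = begin
      j               ≡⟨ sym (m<n⇒m%n≡m j<m) ⟩
      j % m           ≡⟨ cong (_% m) (sym (m+[n∸m]≡n (<⇒≤ (<ᵇ-true⁻ i<ᵇj)))) ⟩
      (i + (j ∸ i)) % m ≡⟨ cong (λ d → (i + d) % m) span≡k ⟩
      (i + k) % m     ∎
      where open ≡-Reasoning
    ... | false = begin
      j               ≡⟨ sym (m<n⇒m%n≡m j<m) ⟩
      j % m           ≡⟨ sym ([m+n]%n≡m%n j m) ⟩
      (j + m) % m     ≡⟨ cong (_% m) (trans (+-comm j m) (sym (m+[n∸m]≡n (≤-trans (<⇒≤ i<m) (m≤m+n m j))))) ⟩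
      (i + ((m + j) ∸ i)) % m ≡⟨ cong (λ d → (i + d) % m) span≡k ⟩
      (i + k) % m     ∎
      where open ≡-Reasoning

    spanℕ-partner : ∀ {i k} → i < m → 1 ≤ k → k < m → spanℕ i ((i + k) % m) ≡ k × (i + k) % m ≢ i
    spanℕ-partner {i} {k} i<m 1≤k k<m with i + k <? m
    ... | yes i+k<m rewrite m<n⇒m%n≡m i+k<m | <ᵇ-true (m<m+n i 1≤k) = m+n∸m≡n i k , <⇒≢ (m<m+n i 1≤k) ∘ sym
    ... | no i+k≮m = span≡k , λ eq → <⇒≢ j<i (trans (sym [i+k]%m≡j) eq)
      where
      j = (i + k) ∸ m
      i+k≡j+m : i + k ≡ j + m
      i+k≡j+m = sym (m∸n+n≡m (≮⇒≥ i+k≮m))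
      j<i : j < i
      j<i = +-cancelʳ-< m j i (subst (_< i + m) i+k≡j+m (+-monoʳ-< i k<m))
      [i+k]%m≡j : (i + k) % m ≡ j
      [i+k]%m≡j = trans (cong (_% m) i+k≡j+m) (trans ([m+n]%n≡m%n j m) (m<n⇒m%n≡m (<-trans j<i i<m)))
      span≡k : spanℕ i ((i + k) % m) ≡ k
      span≡k = begin
        spanℕ i ((i + k) % m)  ≡⟨ cong (spanℕ i) [i+k]%m≡j ⟩
        spanℕ i j              ≡⟨ cong (λ b → if b then j ∸ i else (m + j) ∸ i) (<ᵇ-false (<⇒≤ j<i)) ⟩
        (m + j) ∸ i            ≡⟨ cong (_∸ i) (trans (+-comm m j) (sym i+k≡j+m)) ⟩
        (i + k) ∸ i            ≡⟨ m+n∸m≡n i k ⟩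
        k                      ∎
        where open ≡-Reasoning

    InSpan⇒partner : ∀ {k x y} → x < n → y < n → InSpan k x y ≡ true → y ≡ elem% (count x + k)
    InSpan⇒partner {k} {x} {y} x<n y<n inSpan with x ∈ᵇ A in x∈A | y ∈ᵇ A in y∈A | x ≡ᵇ y in x≡ᵇy
    ... | true | true | false = trans (sym (elem-count y∈A y<n))
                                      (cong elem (spanℕ⇒partner (count<m x∈A x<n) (count<m y∈A y<n) (≡ᵇ-true⁻ inSpan)))

    InSpan-partner : ∀ {i k} → i < m → 1 ≤ k → k < m → InSpan k (elem i) (elem% (i + k)) ≡ true
    InSpan-partner {i} {k} i<m 1≤k k<m
      rewrite χ-elem i<m | χ-elem% (i + k) | count-elem i<m | count-elem (m%n<n (i + k) m)
            | proj₁ (spanℕ-partner i<m 1≤k k<m) | ≡ᵇ-true k = cong (λ b → not b ∧ true) (≡ᵇ-false elem≢)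
      where
      elem≢ : elem i ≢ elem% (i + k)
      elem≢ eq = proj₂ (spanℕ-partner i<m 1≤k k<m)
                   (trans (sym (count-elem (m%n<n (i + k) m))) (trans (cong count (sym eq)) (count-elem i<m)))

    sigma-list : ∀ (g : ℕ → ℕ → ℕ) k → 1 ≤ k → k < m →
      concat (applyUpTo (λ x → concat (applyUpTo (λ y → if InSpan k x y then [ g x y ] else []) n)) n)
        ≡ applyUpTo (λ i → g (elem i) (elem% (i + k))) m
    sigma-list g k 1≤k k<m =
      trans (concat-members n ≤-refl _ partner row)
            (applyUpTo-cong m (λ i i<m → cong (λ c → g (elem i) (elem% (c + k))) (count-elem i<m)))
      where
      partner : ℕ → ℕ
      partner x = g x (elem% (count x + k))
      row : ∀ x → x < n → concat (applyUpTo (λ y → if InSpan k x y then [ g x y ] else []) n)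
                          ≡ (if x ∈ᵇ A then [ partner x ] else [])
      row x x<n = by-membership (x ∈ᵇ A) refl
        where
        by-membership : ∀ b → x ∈ᵇ A ≡ b → concat (applyUpTo (λ y → if InSpan k x y then [ g x y ] else []) n)
                                            ≡ (if b then [ partner x ] else [])
        by-membership false x∉A = concat-applyUpTo-[] n _ (λ y _ → cong (λ b → if b ∧ y ∈ᵇ A ∧ not (x ≡ᵇ y) ∧ (spanℕ (count x) (count y) ≡ᵇ k) then [ g x y ] else []) x∉A)
        by-membership true  x∈A = trans (concat-applyUpTo-single n (elem% (count x + k)) _ (elem%<n _) others) hit
          where
          others : ∀ y → y < n → y ≢ elem% (count x + k) → (if InSpan k x y then [ g x y ] else []) ≡ []
          others y y<n y≢ with InSpan k x y in inSpan
          ... | true  = ⊥-elim (y≢ (InSpan⇒partner x<n y<n inSpan))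
          ... | false = refl
          inSpan : InSpan k x (elem% (count x + k)) ≡ true
          inSpan = subst (λ z → InSpan k z (elem% (count x + k)) ≡ true) (elem-count x∈A x<n)
                         (InSpan-partner (count<m x∈A x<n) 1≤k k<m)
          hit : (if InSpan k x (elem% (count x + k)) then [ g x (elem% (count x + k)) ] else []) ≡ [ partner x ]
          hit rewrite inSpan = refl

    dstarℕ-elem%-forward : ∀ i k → k < m → dstarℕ (elem% i) (elem% (i + k)) ≡ arc k i
    dstarℕ-elem%-forward i k k<m = begin
      dstarℕ (elem% i) (elem% (i + k))                 ≡⟨ sym (cong₂ dstarℕ (unroll-%n i) (unroll-%n (i + k))) ⟩
      dstarℕ (unroll i % n) (unroll (i + k) % n)       ≡⟨ dstarℕ-% (unroll-mono-≤ (m≤m+n i k)) (unroll-+< i k<m) ⟩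
      arc k i                                          ∎
      where open ≡-Reasoning

    dstarℕ-elem%-backward : ∀ i k → 1 ≤ k → k < m → dstarℕ (elem% (i + k)) (elem% i) ≡ n ∸ arc k i
    dstarℕ-elem%-backward i k 1≤k k<m = begin
      dstarℕ (elem% (i + k)) (elem% i)                         ≡⟨ sym (cong₂ dstarℕ (unroll-%n (i + k)) (trans ([m+n]%n≡m%n (unroll i) n) (unroll-%n i))) ⟩
      dstarℕ (unroll (i + k) % n) ((unroll i + n) % n)         ≡⟨ dstarℕ-% (unroll-+≤ i (<⇒≤ k<m)) (+-monoˡ-< n (unroll-mono-< (m<m+n i 1≤k))) ⟩
      (unroll i + n) ∸ unroll (i + k)                          ≡⟨ [a+n]∸b≡n∸[b∸a] (unroll-mono-≤ (m≤m+n i k)) ⟩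
      n ∸ arc k i                                              ∎
      where open ≡-Reasoning

    distℕ-elem% : ∀ i k → 1 ≤ k → k < m → distℕ (elem% i) (elem% (i + k)) ≡ geodesic (arc k i)
    distℕ-elem% i k 1≤k k<m = cong₂ _⊓_ (dstarℕ-elem%-forward i k k<m) (dstarℕ-elem%-backward i k 1≤k k<m)

    σ*≡arcs : ∀ k → 1 ≤ k → k < m → σ* A k ≡ applyUpTo (arc k) m
    σ*≡arcs k 1≤k k<m = trans (sigmaWith≡ dstar dstarℕ (λ _ _ → refl) k)
      (trans (sigma-list dstarℕ k 1≤k k<m)
             (applyUpTo-cong m (λ i i<m → trans (cong (λ x → dstarℕ x (elem% (i + k))) (sym (elem%≡elem i<m)))
                                                (dstarℕ-elem%-forward i k k<m))))

    σ≡geodesic-arcs : ∀ k → 1 ≤ k → k < m → σ A k ≡ applyUpTo (geodesic ∘ arc k) m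
    σ≡geodesic-arcs k 1≤k k<m = trans (sigmaWith≡ dist distℕ (λ _ _ → refl) k)
      (trans (sigma-list distℕ k 1≤k k<m)
             (applyUpTo-cong m (λ i i<m → trans (cong (λ x → distℕ x (elem% (i + k))) (sym (elem%≡elem i<m)))
                                                (distℕ-elem% i k 1≤k k<m))))

    ∑-others : ∀ {i} → i < m → (g : ℕ → ℕ) →
      ∑ n (λ y → if y ∈ᵇ A ∧ not (y ≡ᵇ elem i) then g y else 0) ≡ ∑ m-1 (λ k → g (elem% (i + suc k)))
    ∑-others {i} i<m g = begin
      ∑ n (λ y → if y ∈ᵇ A ∧ not (y ≡ᵇ elem i) then g y else 0) ≡⟨ ∑-cong n (λ y _ → split y) ⟩
      ∑ n (λ y → if y ∈ᵇ A then f y else 0)                        ≡⟨ ∑-members n ≤-refl f ⟩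
      ∑ m (f ∘ elem)                                               ≡⟨ ∑-cong m (λ j j<m → cong f (sym (elem%≡elem j<m))) ⟩
      ∑ m (f ∘ elem%)                                              ≡⟨ sym (∑-translate-periodic m (f ∘ elem%) (cong f ∘ elem%-+m) i) ⟩
      ∑ m (λ k → f (elem% (k + i)))                                ≡⟨ ∑-cong m (λ k _ → cong (f ∘ elem%) (+-comm k i)) ⟩
      ∑ m (λ k → f (elem% (i + k)))                                ≡⟨ cong (λ l → ∑ l (λ k → f (elem% (i + k)))) (sym 1+m-1≡m) ⟩
      ∑ (suc m-1) (λ k → f (elem% (i + k)))                        ≡⟨ ∑-head m-1 _ ⟩
      f (elem% (i + 0)) + ∑ m-1 (λ k → f (elem% (i + suc k)))      ≡⟨ cong₂ _+_ self (∑-cong m-1 (λ k k<m-1 → other (1+k<m k<m-1))) ⟩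
      ∑ m-1 (λ k → g (elem% (i + suc k)))                          ∎
      where
      open ≡-Reasoning
      f : ℕ → ℕ
      f y = if not (y ≡ᵇ elem i) then g y else 0
      split : ∀ y → (if y ∈ᵇ A ∧ not (y ≡ᵇ elem i) then g y else 0) ≡ (if y ∈ᵇ A then f y else 0)
      split y with y ∈ᵇ A
      ... | true  = refl
      ... | false = refl
      self : f (elem% (i + 0)) ≡ 0
      self rewrite +-identityʳ i | elem%≡elem i<m | ≡ᵇ-true (elem i) = refl
      other : ∀ {k} → suc k < m → f (elem% (i + suc k)) ≡ g (elem% (i + suc k))
      other {k} 1+k<m rewrite ≡ᵇ-false {elem% (i + suc k)} {elem i} (λ eq → proj₂ (spanℕ-partner i<m (s≤s z≤n) 1+k<m)
                                 (trans (sym (count-elem (m%n<n (i + suc k) m))) (trans (cong count eq) (count-elem i<m)))) = refl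

    W+W≡∑∑geodesic-arc : W A + W A ≡ ∑ m-1 (λ k → ∑ m (λ i → geodesic (arc (suc k) i)))
    W+W≡∑∑geodesic-arc = begin
      W A + W A                                                   ≡⟨ W+W≡Q A ⟩
      Q (_∈ᵇ A)                                                   ≡⟨ ∑-members n ≤-refl (potential (_∈ᵇ A)) ⟩
      ∑ m (λ i → potential (_∈ᵇ A) (elem i))                      ≡⟨ ∑-cong m (λ i i<m → row i<m) ⟩
      ∑ m (λ i → ∑ m-1 (λ k → geodesic (arc (suc k) i)))          ≡⟨ ∑-comm m m-1 _ ⟩
      ∑ m-1 (λ k → ∑ m (λ i → geodesic (arc (suc k) i)))          ∎
      where
      open ≡-Reasoning
      row : ∀ {i} → i < m → potential (_∈ᵇ A) (elem i) ≡ ∑ m-1 (λ k → geodesic (arc (suc k) i))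
      row {i} i<m = begin
        potential (_∈ᵇ A) (elem i)                                                 ≡⟨ ∑-cong n (λ y _ → drop-self y) ⟩
        ∑ n (λ y → if y ∈ᵇ A ∧ not (y ≡ᵇ elem i) then distℕ (elem i) y else 0)     ≡⟨ ∑-others i<m (distℕ (elem i)) ⟩
        ∑ m-1 (λ k → distℕ (elem i) (elem% (i + suc k)))                           ≡⟨ ∑-cong m-1 (λ k k<m-1 → trans (cong (λ x → distℕ x (elem% (i + suc k))) (sym (elem%≡elem i<m)))
                                                                                                               (distℕ-elem% i (suc k) (s≤s z≤n) (1+k<m k<m-1))) ⟩
        ∑ m-1 (λ k → geodesic (arc (suc k) i))                                     ∎
        where
        drop-self : ∀ y → (if y ∈ᵇ A then distℕ (elem i) y else 0) ≡ (if y ∈ᵇ A ∧ not (y ≡ᵇ elem i) then distℕ (elem i) y else 0)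
        drop-self y with y ∈ᵇ A | y ≡ᵇ elem i in y≡ᵇ
        ... | false | _     = refl
        ... | true  | false = refl
        ... | true  | true  = trans (cong (distℕ (elem i)) (≡ᵇ-true⁻ y≡ᵇ)) (distℕ-refl (elem i))

    ∑-geodesic-arc-complement : ∀ k → k ≤ m → ∑ m (geodesic ∘ arc k) ≡ ∑ m (geodesic ∘ arc (m ∸ k))
    ∑-geodesic-arc-complement k k≤m = sym (begin
      ∑ m (geodesic ∘ arc (m ∸ k))                     ≡⟨ sym (∑-translate-periodic m (geodesic ∘ arc (m ∸ k)) (λ i → cong geodesic (arc-+m (m ∸ k) i)) k) ⟩
      ∑ m (λ i → geodesic (arc (m ∸ k) (i + k)))       ≡⟨ ∑-cong m (λ i _ → cong geodesic (arc-complement k i k≤m)) ⟩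
      ∑ m (λ i → geodesic (n ∸ arc k i))               ≡⟨ ∑-cong m (λ i _ → geodesic-reflect (arc≤n k i k≤m)) ⟩
      ∑ m (geodesic ∘ arc k)                           ∎)
      where open ≡-Reasoning

module LocalMaximum {n} (A : Subset n) (m≥2 : 2 ≤ OnSubset.m A) (local : LocalMaximizer A) where
  open Cycle n
  open TotalDistance n
  open OnSubset A
  open Positive (≤-trans (s≤s z≤n) m≥2)

  n≥2 : 2 ≤ n
  n≥2 = ≤-trans m≥2 m≤n

  next : ℕ → ℕ
  next i = (elem i + 1) % n

  next<n : ∀ i → next i < n
  next<n i = m%n<n (elem i + 1) n

  next∈A⇒unroll-suc : ∀ {i} → i < m → next i ∈ᵇ A ≡ true → unroll (suc i) ≡ suc (unroll i)
  next∈A⇒unroll-suc {i} i<m next∈A with suc (elem i) <? n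
  ... | yes 1+elem<n = begin
    unroll (suc i)          ≡⟨ cong unroll (sym count≡) ⟩
    unroll (count x)        ≡⟨ unroll≡elem (count<m x∈A 1+elem<n) ⟩
    elem (count x)          ≡⟨ elem-count x∈A 1+elem<n ⟩
    suc (elem i)            ≡⟨ cong suc (sym (unroll≡elem i<m)) ⟩
    suc (unroll i)          ∎
    where
    open ≡-Reasoning
    x = suc (elem i)
    x≡next : x ≡ next i
    x≡next = trans (sym (m<n⇒m%n≡m 1+elem<n)) (cong (_% n) (+-comm 1 (elem i)))
    x∈A : x ∈ᵇ A ≡ true
    x∈A = trans (cong (_∈ᵇ A) x≡next) next∈A
    count≡ : count x ≡ suc i
    count≡ = trans (count-suc (χ-elem i<m)) (cong suc (count-elem i<m))
  ... | no 1+elem≮n = begin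
    unroll (suc i)          ≡⟨ cong unroll (trans (cong suc (sym (count-elem i<m))) (trans (sym (count-suc (χ-elem i<m))) (cong count 1+elem≡n))) ⟩
    unroll m                ≡⟨ cong unroll (sym (+-identityˡ m)) ⟩
    unroll (0 + m)          ≡⟨ unroll-+m 0 ⟩
    unroll 0 + n            ≡⟨ cong (_+ n) (trans (unroll≡elem (≤-trans (s≤s z≤n) m≥2)) (elem-count 0∈A (≤-trans (s≤s z≤n) n≥2))) ⟩
    n                       ≡⟨ sym 1+elem≡n ⟩
    suc (elem i)            ≡⟨ cong suc (sym (unroll≡elem i<m)) ⟩
    suc (unroll i)          ∎
    where
    open ≡-Reasoning
    1+elem≡n : suc (elem i) ≡ n
    1+elem≡n = ≤-antisym (elem<n i<m) (≮⇒≥ 1+elem≮n)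
    0∈A : 0 ∈ᵇ A ≡ true
    0∈A = trans (cong (_∈ᵇ A) (sym (trans (cong (_% n) (trans (+-comm (elem i) 1) 1+elem≡n)) (n%n≡0 n)))) next∈A

  next∉A : ∀ {i} → i < m → HoleAfter i → next i ∈ᵇ A ≡ false
  next∉A {i} i<m hole with next i ∈ᵇ A in next∈A
  ... | false = refl
  ... | true  = ⊥-elim (<-irrefl refl (≤-trans hole (≤-reflexive (next∈A⇒unroll-suc i<m next∈A))))

  distℕ-elem-next : ∀ {i} → i < m → distℕ (elem i) (next i) ≡ 1
  distℕ-elem-next {i} i<m = trans (cong₂ _⊓_ forward backward) (m≤n⇒m⊓n≡m (m+n≤o⇒m≤o∸n 1 n≥2))
    where
    x = elem i
    x%n≡x : x % n ≡ x
    x%n≡x = m<n⇒m%n≡m (elem<n i<m)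
    forward : dstarℕ x (next i) ≡ 1
    forward = trans (cong (λ y → dstarℕ y (next i)) (sym x%n≡x))
                    (trans (dstarℕ-% (m≤m+n x 1) (+-monoʳ-< x n≥2)) (m+n∸m≡n x 1))
    backward : dstarℕ (next i) x ≡ n ∸ 1
    backward = trans (cong (dstarℕ (next i)) (trans (sym x%n≡x) (sym ([m+n]%n≡m%n x n))))
                     (trans (dstarℕ-% (+-monoʳ-≤ x (≤-trans (s≤s z≤n) n≥2)) (≤-reflexive (sym (trans (+-assoc x 1 n) (+-suc x n)))))
                            ([m+n]∸[m+o]≡n∸o x n 1))

  distℕ-next : ∀ {i k} → i < m → HoleAfter i → 1 ≤ k → k < m → distℕ (next i) (elem% (i + k)) ≡ geodesic (arc k i ∸ 1)
  distℕ-next {i} {k} i<m hole 1≤k k<m = cong₂ _⊓_ forward backward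
    where
    y = unroll i + 1
    next≡ : next i ≡ y % n
    next≡ = cong (λ z → (z + 1) % n) (sym (unroll≡elem i<m))
    y<unroll-i+k : y < unroll (i + k)
    y<unroll-i+k = ≤-trans (≤-reflexive (cong suc (+-comm (unroll i) 1))) (≤-trans hole (unroll-mono-≤ (≤-trans (≤-reflexive (+-comm 1 i)) (+-monoʳ-≤ i 1≤k))))
    arc-1 : unroll (i + k) ∸ y ≡ arc k i ∸ 1
    arc-1 = sym (∸-+-assoc (unroll (i + k)) (unroll i) 1)
    forward : dstarℕ (next i) (elem% (i + k)) ≡ arc k i ∸ 1
    forward = trans (cong₂ dstarℕ next≡ (sym (unroll-%n (i + k))))
                    (trans (dstarℕ-% (<⇒≤ y<unroll-i+k) (<-≤-trans (unroll-+< i k<m) (+-monoˡ-≤ n (m≤m+n (unroll i) 1)))) arc-1)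
    backward : dstarℕ (elem% (i + k)) (next i) ≡ n ∸ (arc k i ∸ 1)
    backward = trans (cong₂ dstarℕ (sym (unroll-%n (i + k))) (trans next≡ (sym ([m+n]%n≡m%n y n))))
                     (trans (dstarℕ-% (≤-trans (<⇒≤ (unroll-+< i k<m)) (+-monoˡ-≤ n (m≤m+n (unroll i) 1))) (+-monoˡ-< n y<unroll-i+k))
                            (trans ([a+n]∸b≡n∸[b∸a] (<⇒≤ y<unroll-i+k)) (cong (n ∸_) arc-1)))

  -- Moving a_i into the hole after it is a perturbation that shortens every arc from a_i by one.
  hole⇒no-gain : ∀ {i} → i < m → HoleAfter i →
    ∑ m-1 (λ k → geodesic (arc (suc k) i ∸ 1)) ≤ ∑ m-1 (λ k → geodesic (arc (suc k) i))
  hole⇒no-gain {i} i<m hole = subst₂ _≤_ potential-v potential-u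
    (+-cancelˡ-≤ (W A) _ _ (begin
      W A + potential Y (toℕ v)     ≡⟨ sym (Exchange.W-exchange A u∈A v∉A) ⟩
      W B + potential Y (toℕ u)     ≤⟨ +-monoˡ-≤ _ (local B (u , v , u∈A , v∉A , distℕ-u-v , refl)) ⟩
      W A + potential Y (toℕ u)     ∎))
    where
    open ≤-Reasoning
    u v : Fin n
    u = fromℕ< (elem<n i<m)
    v = fromℕ< (next<n i)
    u∈A : u ∈ A
    u∈A = ∈ᵇ⇒∈ (trans (cong (_∈ᵇ A) (toℕ-fromℕ< (elem<n i<m))) (χ-elem i<m))
    v∉A : v ∉ A
    v∉A v∈A with trans (sym (∈⇒∈ᵇ v∈A)) (trans (cong (_∈ᵇ A) (toℕ-fromℕ< (next<n i))) (next∉A i<m hole))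
    ... | ()
    distℕ-u-v : dist u v ≡ 1
    distℕ-u-v = trans (cong₂ distℕ (toℕ-fromℕ< (elem<n i<m)) (toℕ-fromℕ< (next<n i))) (distℕ-elem-next i<m)
    B = Exchange.B A u∈A v∉A
    Y = Exchange.Y A u∈A v∉A
    potential-others : ∀ w → potential Y w ≡ ∑ m-1 (λ k → distℕ w (elem% (i + suc k)))
    potential-others w = trans (cong (λ c → potential (λ x → x ∈ᵇ A ∧ not (x ≡ᵇ c)) w) (toℕ-fromℕ< (elem<n i<m)))
                               (∑-others i<m (distℕ w))
    potential-u : potential Y (toℕ u) ≡ ∑ m-1 (λ k → geodesic (arc (suc k) i))
    potential-u = trans (potential-others (toℕ u)) (∑-cong m-1 (λ k k<m-1 →
      trans (cong (λ x → distℕ x (elem% (i + suc k))) (trans (toℕ-fromℕ< (elem<n i<m)) (sym (elem%≡elem i<m))))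
            (distℕ-elem% i (suc k) (s≤s z≤n) (1+k<m k<m-1))))
    potential-v : potential Y (toℕ v) ≡ ∑ m-1 (λ k → geodesic (arc (suc k) i ∸ 1))
    potential-v = trans (potential-others (toℕ v)) (∑-cong m-1 (λ k k<m-1 →
      trans (cong (λ x → distℕ x (elem% (i + suc k))) (toℕ-fromℕ< (next<n i)))
            (distℕ-next i<m hole (s≤s z≤n) (1+k<m k<m-1))))

  hole⇒¬long-arcs : ∀ {i} → i < m → HoleAfter i → ∀ a c b → a + c + b ≡ m-1 → a < b →
    (∀ k → k < m-1 → a ≤ k → n < arc (suc k) i + arc (suc k) i) →
    (∀ k → k < m-1 → a + c ≤ k → suc n < arc (suc k) i + arc (suc k) i) → ⊥
  hole⇒¬long-arcs {i} i<m hole a c b a+c+b≡ a<b long longer =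
    <⇒≱ a<b (+-cancelˡ-≤ (∑ m-1 (geodesic ∘ t)) b a
      (≤-trans (∑-geodesic-pred m-1 a c b t a+c+b≡ bounds long longer) (+-monoˡ-≤ a (hole⇒no-gain i<m hole))))
    where
    t : ℕ → ℕ
    t k = arc (suc k) i
    bounds : ∀ k → k < m-1 → 1 ≤ t k × t k ≤ n
    bounds k k<m-1 = 1≤arc (suc k) i (s≤s z≤n) , arc≤n (suc k) i (<⇒≤ (1+k<m k<m-1))

  long-arc⇒hole-below-m : ∀ r {len} j → r < len → len ≤ arc r j → ∃ λ i → i < m × HoleAfter i × len ≤ arc r i
  long-arc⇒hole-below-m r {len} j r<len long with long-arc⇒hole r j r<len long
  ... | x , long′ , hole = x % m , m%n<n x m , HoleAfter-% x hole , subst (len ≤_) (arc-% r x) long′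

  arc≤⌊n/2⌋ : ∀ r → m ≡ suc (suc r + suc r) → ∀ j → arc (suc r) j ≤ ⌊n/2⌋
  arc≤⌊n/2⌋ r m≡ j = ≮⇒≥ (λ long → no-long-arc (long-arc⇒hole-below-m (suc r) j (s≤s 1+r≤⌊n/2⌋) long))
    where
    1+r≤⌊n/2⌋ : suc r ≤ ⌊n/2⌋
    1+r≤⌊n/2⌋ = r+r≤n⇒r≤⌊n/2⌋ (<⇒≤ (subst (_≤ n) m≡ m≤n))
    a+c+b≡ : r + 1 + suc r ≡ m-1
    a+c+b≡ = trans (cong (_+ suc r) (+-comm r 1)) (cong (_∸ 1) (sym m≡))
    no-long-arc : (∃ λ i → i < m × HoleAfter i × suc ⌊n/2⌋ ≤ arc (suc r) i) → ⊥
    no-long-arc (i , i<m , hole , long) = hole⇒¬long-arcs i<m hole r 1 (suc r) a+c+b≡ ≤-refl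
      (λ k _ r≤k → ⌊n/2⌋<t⇒n<t+t (≤-trans long (arc-mono-≤ i (s≤s r≤k))))
      (λ k _ r+1≤k → 1+⌊n/2⌋<t⇒1+n<t+t (≤-trans (s≤s long) (arc-mono-< i (s≤s (≤-trans (≤-reflexive (+-comm 1 r)) r+1≤k)))))

  arc≤⌈n/2⌉ : ∀ r → m ≡ suc r + suc r → ∀ j → arc (suc r) j ≤ ⌈n/2⌉
  arc≤⌈n/2⌉ r m≡ j = ≮⇒≥ (λ long → no-long-arc (long-arc⇒hole-below-m (suc r) j (s≤s (≤-trans 1+r≤⌊n/2⌋ ⌊n/2⌋≤⌈n/2⌉)) long))
    where
    1+r≤⌊n/2⌋ : suc r ≤ ⌊n/2⌋
    1+r≤⌊n/2⌋ = r+r≤n⇒r≤⌊n/2⌋ (subst (_≤ n) m≡ m≤n)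
    a+c+b≡ : r + 0 + suc r ≡ m-1
    a+c+b≡ = trans (cong (_+ suc r) (+-identityʳ r)) (cong (_∸ 1) (sym m≡))
    no-long-arc : (∃ λ i → i < m × HoleAfter i × suc ⌈n/2⌉ ≤ arc (suc r) i) → ⊥
    no-long-arc (i , i<m , hole , long) = hole⇒¬long-arcs i<m hole r 0 (suc r) a+c+b≡ ≤-refl
      (λ k k<m-1 r≤k → <-trans (n<1+n n) (longer k k<m-1 (≤-trans (≤-reflexive (+-identityʳ r)) r≤k)))
      longer
      where
      longer : ∀ k → k < m-1 → r + 0 ≤ k → suc n < arc (suc k) i + arc (suc k) i
      longer k _ r≤k = ⌈n/2⌉<t⇒1+n<t+t (≤-trans long (arc-mono-≤ i (s≤s (≤-trans (≤-reflexive (sym (+-identityʳ r))) r≤k))))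

data Halving (m : ℕ) : Set where
  odd  : ∀ r → m ≡ suc (suc r + suc r) → m % 2 ≡ 1 → m / 2 ≡ suc r → Halving m
  even : ∀ r → m ≡ suc r + suc r       → m % 2 ≡ 0 → m / 2 ≡ suc r → Halving m

halving : ∀ m → 2 ≤ m → Halving m
halving m m≥2 with m / 2 in m/2≡ | m % 2 in m%2≡ | m≡m%n+[m/n]*n m 2 | m%n<n m 2
... | zero  | b           | m≡ | _ = ⊥-elim (<⇒≱ (m%n<n m 2) (≤-trans m≥2 (≤-reflexive (trans m≡ (trans (+-identityʳ b) (sym m%2≡))))))
... | suc r | zero        | m≡ | _ = even r (trans m≡ (double (suc r))) m%2≡ m/2≡
  where
  double : ∀ x → x * 2 ≡ x + x
  double x = trans (*-comm x 2) (cong (x +_) (+-identityʳ x))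
... | suc r | suc zero    | m≡ | _ = odd r (trans m≡ (cong suc (trans (*-comm (suc r) 2) (cong (suc r +_) (+-identityʳ (suc r)))))) m%2≡ m/2≡
... | suc r | suc (suc b) | _  | s≤s (s≤s ())

-- The maximum of sum (σ A k) over the m-subsets A of C_n.
bound : ℕ → ℕ → ℕ → ℕ
bound n m k = if k + k <ᵇ m then k * n else if k + k ≡ᵇ m then m * (n / 2) else (m ∸ k) * n

bound-< : ∀ n m k → k + k < m → bound n m k ≡ k * n
bound-< n m k k+k<m rewrite <ᵇ-true k+k<m = refl

bound-≡ : ∀ n m k → k + k ≡ m → bound n m k ≡ m * (n / 2)
bound-≡ n m k k+k≡m rewrite <ᵇ-false (≤-reflexive (sym k+k≡m)) | k+k≡m | ≡ᵇ-true m = refl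

bound-> : ∀ n m k → m < k + k → bound n m k ≡ (m ∸ k) * n
bound-> n m k m<k+k rewrite <ᵇ-false (<⇒≤ m<k+k) | ≡ᵇ-false (<⇒≢ m<k+k ∘ sym) = refl

module Conditions {n} (A : Subset n) (m≥2 : 2 ≤ OnSubset.m A) where
  open Cycle n
  open OnSubset A
  open Positive (≤-trans (s≤s z≤n) m≥2) public

  ∈σ*⇒arc : ∀ {k x} → 1 ≤ k → k < m → x ∈ₗ σ* A k → ∃ λ i → i < m × x ≡ arc k i
  ∈σ*⇒arc {k} {x} 1≤k k<m x∈σ* = ∈-applyUpTo⁻ (arc k) (subst (x ∈ₗ_) (σ*≡arcs k 1≤k k<m) x∈σ*)

  ∈σ⇒geodesic-arc : ∀ {k x} → 1 ≤ k → k < m → x ∈ₗ σ A k → ∃ λ i → i < m × x ≡ geodesic (arc k i)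
  ∈σ⇒geodesic-arc {k} {x} 1≤k k<m x∈σ = ∈-applyUpTo⁻ (geodesic ∘ arc k) (subst (x ∈ₗ_) (σ≡geodesic-arcs k 1≤k k<m) x∈σ)

  geodesic-arc∈σ : ∀ {k i} → 1 ≤ k → k < m → i < m → geodesic (arc k i) ∈ₗ σ A k
  geodesic-arc∈σ {k} {i} 1≤k k<m i<m = subst (geodesic (arc k i) ∈ₗ_) (sym (σ≡geodesic-arcs k 1≤k k<m)) (∈-applyUpTo⁺ (geodesic ∘ arc k) i<m)

  arc∈σ* : ∀ {k i} → 1 ≤ k → k < m → i < m → arc k i ∈ₗ σ* A k
  arc∈σ* {k} {i} 1≤k k<m i<m = subst (arc k i ∈ₗ_) (sym (σ*≡arcs k 1≤k k<m)) (∈-applyUpTo⁺ (arc k) i<m)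

  short-arcs⇒σ↭σ* : ∀ k → 1 ≤ k → k < m → (∀ i → i < m → arc k i + arc k i ≤ n) → σ A k ↭ σ* A k
  short-arcs⇒σ↭σ* k 1≤k k<m short = ↭-reflexive (begin
    σ A k                           ≡⟨ σ≡geodesic-arcs k 1≤k k<m ⟩
    applyUpTo (geodesic ∘ arc k) m  ≡⟨ applyUpTo-cong m (λ i i<m → t+t≤n⇒geodesic≡t (short i i<m)) ⟩
    applyUpTo (arc k) m             ≡⟨ sym (σ*≡arcs k 1≤k k<m) ⟩
    σ* A k                          ∎)
    where open ≡-Reasoning

  sum-σ : ∀ k → 1 ≤ k → k < m → sum (σ A k) ≡ ∑ m (geodesic ∘ arc k)
  sum-σ k 1≤k k<m = trans (cong sum (σ≡geodesic-arcs k 1≤k k<m)) (sum-applyUpTo m _)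

  sum-σ* : ∀ k → 1 ≤ k → k < m → sum (σ* A k) ≡ k * n
  sum-σ* k 1≤k k<m = trans (cong sum (σ*≡arcs k 1≤k k<m)) (trans (sum-applyUpTo m _) (∑-arc k))

  W+W≡∑sum-σ : W A + W A ≡ ∑ m-1 (λ k → sum (σ A (suc k)))
  W+W≡∑sum-σ = trans W+W≡∑∑geodesic-arc (∑-cong m-1 (λ k k<m-1 → sym (sum-σ (suc k) (s≤s z≤n) (1+k<m k<m-1))))

  1+r<m : ∀ {r} → suc r + suc r ≤ m → suc r < m
  1+r<m {r} 2r+2≤m = ≤-trans (s≤s (s≤s (m≤m+n r r))) (≤-trans (≤-reflexive (cong suc (sym (+-suc r r)))) 2r+2≤m)

  k+k<m⇒k<m : ∀ {k} → k + k < m → k < m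
  k+k<m⇒k<m {k} k+k<m = ≤-<-trans (m≤m+n k k) k+k<m

  2*k≡k+k : ∀ k → 2 * k ≡ k + k
  2*k≡k+k k = cong (k +_) (+-identityʳ k)

  local⇒cond3 : LocalMaximizer A → Cond3 m A
  local⇒cond3 local with halving m m≥2
  ... | odd r m≡ m%2≡1 m/2≡ = odd-part , λ m%2≡0 → ⊥-elim (1+n≢0 (trans (sym m%2≡1) m%2≡0))
    where
    r+1<m : suc r < m
    r+1<m = 1+r<m (≤-trans (n≤1+n _) (≤-reflexive (sym m≡)))
    odd-part : m % 2 ≡ 1 → ∀ x → x ∈ₗ σ* A (m / 2) → 1 ≤ x × x ≤ n / 2
    odd-part _ x x∈σ* with ∈σ*⇒arc (s≤s z≤n) r+1<m (subst (λ k → x ∈ₗ σ* A k) m/2≡ x∈σ*)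
    ... | i , i<m , refl = 1≤arc (suc r) i (s≤s z≤n) , LocalMaximum.arc≤⌊n/2⌋ A m≥2 local r m≡ i
  ... | even r m≡ m%2≡0 m/2≡ = (λ m%2≡1 → ⊥-elim (1+n≢0 (trans (sym m%2≡1) m%2≡0))) , even-part
    where
    r+1<m : suc r < m
    r+1<m = 1+r<m (≤-reflexive (sym m≡))
    even-part : m % 2 ≡ 0 → ∀ x → x ∈ₗ σ* A (m / 2) → x ≡ n / 2 ⊎ x ≡ n ∸ n / 2
    even-part _ x x∈σ* with ∈σ*⇒arc (s≤s z≤n) r+1<m (subst (λ k → x ∈ₗ σ* A k) m/2≡ x∈σ*)
    ... | i , i<m , refl = ⌊n/2⌋≤t≤⌈n/2⌉ (n∸t≤⌈n/2⌉⇒⌊n/2⌋≤t opposite) (LocalMaximum.arc≤⌈n/2⌉ A m≥2 local r m≡ i)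
      where
      -- the arc of span r starting at a_{i+r} is the complement of this one
      opposite : n ∸ arc (suc r) i ≤ ⌈n/2⌉
      opposite = subst (_≤ ⌈n/2⌉)
        (trans (cong (λ k → arc k (i + suc r)) (sym (trans (cong (_∸ suc r) m≡) (m+n∸n≡m (suc r) (suc r)))))
               (arc-complement (suc r) i (<⇒≤ r+1<m)))
        (LocalMaximum.arc≤⌈n/2⌉ A m≥2 local r m≡ (i + suc r))

  cond3⇒cond4-odd : ∀ r → m ≡ suc (suc r + suc r) → m % 2 ≡ 1 → m / 2 ≡ suc r → Cond3 m A → Cond4 m A
  cond3⇒cond4-odd r m≡ m%2≡1 m/2≡ (cond3 , _) = short-σ↭σ* , λ m%2≡0 → ⊥-elim (1+n≢0 (trans (sym m%2≡1) m%2≡0))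
    where
    r+1<m : suc r < m
    r+1<m = 1+r<m (≤-trans (n≤1+n _) (≤-reflexive (sym m≡)))
    arc≤⌊n/2⌋ : ∀ i → i < m → arc (suc r) i ≤ ⌊n/2⌋
    arc≤⌊n/2⌋ i i<m = proj₂ (cond3 m%2≡1 _ (subst (λ k → arc (suc r) i ∈ₗ σ* A k) (sym m/2≡) (arc∈σ* (s≤s z≤n) r+1<m i<m)))
    short-σ↭σ* : ∀ k → 1 ≤ k → 2 * k < m → σ A k ↭ σ* A k
    short-σ↭σ* k 1≤k 2k<m = short-arcs⇒σ↭σ* k 1≤k (k+k<m⇒k<m k+k<m)
      (λ i i<m → t≤⌊n/2⌋⇒t+t≤n (≤-trans (arc-mono-≤ i k≤r+1) (arc≤⌊n/2⌋ i i<m)))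
      where
      k+k<m : k + k < m
      k+k<m = subst (_< m) (2*k≡k+k k) 2k<m
      k≤r+1 : k ≤ suc r
      k≤r+1 = s≤s⁻¹ (t+t<u+u⇒t<u k (suc (suc r)) (≤-<-trans (s≤s⁻¹ (subst (k + k <_) m≡ k+k<m)) (+-mono-< (n<1+n (suc r)) (n<1+n (suc r)))))

  cond3⇒cond4-even : ∀ r → m ≡ suc r + suc r → m % 2 ≡ 0 → m / 2 ≡ suc r → Cond3 m A → Cond4 m A
  cond3⇒cond4-even r m≡ m%2≡0 m/2≡ (_ , cond3) = short-σ↭σ* , λ _ → all-⌊n/2⌋ , ⌊n/2⌋∈σ
    where
    r+1<m : suc r < m
    r+1<m = 1+r<m (≤-reflexive (sym m≡))
    arc∈halves : ∀ i → i < m → arc (suc r) i ≡ ⌊n/2⌋ ⊎ arc (suc r) i ≡ ⌈n/2⌉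
    arc∈halves i i<m = cond3 m%2≡0 _ (subst (λ k → arc (suc r) i ∈ₗ σ* A k) (sym m/2≡) (arc∈σ* (s≤s z≤n) r+1<m i<m))
    geodesic-arc≡⌊n/2⌋ : ∀ i → i < m → geodesic (arc (suc r) i) ≡ ⌊n/2⌋
    geodesic-arc≡⌊n/2⌋ i i<m with arc∈halves i i<m
    ... | inj₁ arc≡ = trans (cong geodesic arc≡) geodesic-⌊n/2⌋
    ... | inj₂ arc≡ = trans (cong geodesic arc≡) geodesic-⌈n/2⌉
    arc≤⌈n/2⌉ : ∀ i → i < m → arc (suc r) i ≤ ⌈n/2⌉
    arc≤⌈n/2⌉ i i<m with arc∈halves i i<m
    ... | inj₁ arc≡ = ≤-trans (≤-reflexive arc≡) ⌊n/2⌋≤⌈n/2⌉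
    ... | inj₂ arc≡ = ≤-reflexive arc≡
    short-σ↭σ* : ∀ k → 1 ≤ k → 2 * k < m → σ A k ↭ σ* A k
    short-σ↭σ* k 1≤k 2k<m = short-arcs⇒σ↭σ* k 1≤k (k+k<m⇒k<m k+k<m)
      (λ i i<m → t<⌈n/2⌉⇒t+t≤n (<-≤-trans (arc-mono-< i k<r+1) (arc≤⌈n/2⌉ i i<m)))
      where
      k+k<m : k + k < m
      k+k<m = subst (_< m) (2*k≡k+k k) 2k<m
      k<r+1 : k < suc r
      k<r+1 = t+t<u+u⇒t<u k (suc r) (subst (k + k <_) m≡ k+k<m)
    all-⌊n/2⌋ : ∀ x → x ∈ₗ σ A (m / 2) → x ≡ n / 2
    all-⌊n/2⌋ x x∈σ with ∈σ⇒geodesic-arc (s≤s z≤n) r+1<m (subst (λ k → x ∈ₗ σ A k) m/2≡ x∈σ)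
    ... | i , i<m , refl = geodesic-arc≡⌊n/2⌋ i i<m
    ⌊n/2⌋∈σ : n / 2 ∈ₗ σ A (m / 2)
    ⌊n/2⌋∈σ = subst₂ _∈ₗ_ (geodesic-arc≡⌊n/2⌋ 0 (≤-trans (s≤s z≤n) m≥2)) (cong (σ A) (sym m/2≡))
                (geodesic-arc∈σ (s≤s z≤n) r+1<m (≤-trans (s≤s z≤n) m≥2))

  cond3⇒cond4 : Cond3 m A → Cond4 m A
  cond3⇒cond4 with halving m m≥2
  ... | odd  r m≡ m%2≡1 m/2≡ = cond3⇒cond4-odd  r m≡ m%2≡1 m/2≡
  ... | even r m≡ m%2≡0 m/2≡ = cond3⇒cond4-even r m≡ m%2≡0 m/2≡

  sum-σ≤bound : ∀ k → 1 ≤ k → k < m → sum (σ A k) ≤ bound n m k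
  sum-σ≤bound k 1≤k k<m with <-cmp (k + k) m
  ... | tri< k+k<m _ _ = begin
    sum (σ A k)                    ≡⟨ sum-σ k 1≤k k<m ⟩
    ∑ m (geodesic ∘ arc k)         ≤⟨ ∑-mono-≤ m (λ i _ → geodesic≤ (arc k i)) ⟩
    ∑ m (arc k)                    ≡⟨ ∑-arc k ⟩
    k * n                          ≡⟨ sym (bound-< n m k k+k<m) ⟩
    bound n m k                    ∎
    where open ≤-Reasoning
  ... | tri≈ _ k+k≡m _ = begin
    sum (σ A k)                    ≡⟨ sum-σ k 1≤k k<m ⟩
    ∑ m (geodesic ∘ arc k)         ≤⟨ ∑-mono-≤ m (λ i _ → geodesic≤⌊n/2⌋ (arc k i)) ⟩
    ∑ m (λ _ → ⌊n/2⌋)              ≡⟨ ∑-const m ⌊n/2⌋ ⟩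
    m * ⌊n/2⌋                      ≡⟨ sym (bound-≡ n m k k+k≡m) ⟩
    bound n m k                    ∎
    where open ≤-Reasoning
  ... | tri> _ _ m<k+k = begin
    sum (σ A k)                    ≡⟨ sum-σ k 1≤k k<m ⟩
    ∑ m (geodesic ∘ arc k)         ≡⟨ ∑-geodesic-arc-complement k (<⇒≤ k<m) ⟩
    ∑ m (geodesic ∘ arc (m ∸ k))   ≤⟨ ∑-mono-≤ m (λ i _ → geodesic≤ (arc (m ∸ k) i)) ⟩
    ∑ m (arc (m ∸ k))              ≡⟨ ∑-arc (m ∸ k) ⟩
    (m ∸ k) * n                    ≡⟨ sym (bound-> n m k m<k+k) ⟩
    bound n m k                    ∎
    where open ≤-Reasoning

  cond4⇒sum-σ≡k*n : Cond4 m A → ∀ k → 1 ≤ k → k + k < m → sum (σ A k) ≡ k * n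
  cond4⇒sum-σ≡k*n (σ↭σ* , _) k 1≤k k+k<m =
    trans (sum-↭ (σ↭σ* k 1≤k (subst (_< m) (sym (2*k≡k+k k)) k+k<m))) (sum-σ* k 1≤k (k+k<m⇒k<m k+k<m))

  cond4⇒sum-σ≡bound : Cond4 m A → ∀ k → 1 ≤ k → k < m → sum (σ A k) ≡ bound n m k
  cond4⇒sum-σ≡bound cond4@(_ , middle) k 1≤k k<m with <-cmp (k + k) m
  ... | tri< k+k<m _ _ = trans (cond4⇒sum-σ≡k*n cond4 k 1≤k k+k<m) (sym (bound-< n m k k+k<m))
  ... | tri≈ _ k+k≡m _ = begin
    sum (σ A k)                    ≡⟨ sum-σ k 1≤k k<m ⟩
    ∑ m (geodesic ∘ arc k)         ≡⟨ ∑-cong m (λ i i<m → proj₁ (middle m%2≡0) _ (subst (λ l → geodesic (arc k i) ∈ₗ σ A l) (sym m/2≡k) (geodesic-arc∈σ 1≤k k<m i<m))) ⟩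
    ∑ m (λ _ → ⌊n/2⌋)              ≡⟨ ∑-const m ⌊n/2⌋ ⟩
    m * ⌊n/2⌋                      ≡⟨ sym (bound-≡ n m k k+k≡m) ⟩
    bound n m k                    ∎
    where
    open ≡-Reasoning
    m≡k*2 : m ≡ k * 2
    m≡k*2 = trans (sym k+k≡m) (trans (sym (2*k≡k+k k)) (*-comm 2 k))
    m%2≡0 : m % 2 ≡ 0
    m%2≡0 = trans (cong (_% 2) m≡k*2) (m*n%n≡0 k 2)
    m/2≡k : m / 2 ≡ k
    m/2≡k = trans (cong (_/ 2) m≡k*2) (m*n/n≡m k 2)
  ... | tri> _ _ m<k+k = begin
    sum (σ A k)                    ≡⟨ sum-σ k 1≤k k<m ⟩
    ∑ m (geodesic ∘ arc k)         ≡⟨ ∑-geodesic-arc-complement k (<⇒≤ k<m) ⟩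
    ∑ m (geodesic ∘ arc j)         ≡⟨ sym (sum-σ j 1≤j j<m) ⟩
    sum (σ A j)                    ≡⟨ cond4⇒sum-σ≡k*n cond4 j 1≤j j+j<m ⟩
    j * n                          ≡⟨ sym (bound-> n m k m<k+k) ⟩
    bound n m k                    ∎
    where
    open ≡-Reasoning
    j = m ∸ k
    k+j≡m : k + j ≡ m
    k+j≡m = m+[n∸m]≡n (<⇒≤ k<m)
    1≤j : 1 ≤ j
    1≤j = m+n≤o⇒m≤o∸n 1 k<m
    j<m : j < m
    j<m = ∸-monoʳ-< 1≤k (<⇒≤ k<m)
    j<k : j < k
    j<k = +-cancelˡ-< k j k (subst (_< k + k) (sym k+j≡m) m<k+k)
    j+j<m : j + j < m
    j+j<m = subst (j + j <_) k+j≡m (+-monoˡ-< j j<k)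

-- 2W = Σ_k sum σ_k, and every summand is at most its bound, with equality for all k under (4).
cond4⇒maximizer : ∀ {n} (A : Subset n) (m≥2 : 2 ≤ OnSubset.m A) → Cond4 (OnSubset.m A) A → Maximizer A
cond4⇒maximizer {n} A m≥2 cond4 B ∣B∣≡∣A∣ = t+t≤u+u⇒t≤u (begin
  W B + W B                                  ≡⟨ OfB.W+W≡∑sum-σ ⟩
  ∑ (mB ∸ 1) (λ k → sum (σ B (suc k)))       ≤⟨ ∑-mono-≤ (mB ∸ 1) (λ k k<mB-1 → OfB.sum-σ≤bound (suc k) (s≤s z≤n) (OfB.1+k<m k<mB-1)) ⟩
  ∑ (mB ∸ 1) (λ k → bound n mB (suc k))      ≡⟨ cong (λ l → ∑ (l ∸ 1) (λ k → bound n l (suc k))) mB≡mA ⟩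
  ∑ (mA ∸ 1) (λ k → bound n mA (suc k))      ≡⟨ ∑-cong (mA ∸ 1) (λ k k<mA-1 → sym (OfA.cond4⇒sum-σ≡bound cond4 (suc k) (s≤s z≤n) (OfA.1+k<m k<mA-1))) ⟩
  ∑ (mA ∸ 1) (λ k → sum (σ A (suc k)))       ≡⟨ sym OfA.W+W≡∑sum-σ ⟩
  W A + W A                                  ∎)
  where
  open ≤-Reasoning
  mA = OnSubset.m A
  mB = OnSubset.m B
  mB≡mA : mB ≡ mA
  mB≡mA = trans (sym (OnSubset.∣A∣≡m B)) (trans ∣B∣≡∣A∣ (OnSubset.∣A∣≡m A))
  module OfA = Conditions A m≥2
  module OfB = Conditions B (subst (2 ≤_) (sym mB≡mA) m≥2)

theorem4p4 : (n m : ℕ) (A : Subset n) → 2 ≤ m → m ≤ n → ∣ A ∣ ≡ m →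
    (Maximizer A ⇔ LocalMaximizer A) × (Maximizer A ⇔ Cond3 m A) × (Maximizer A ⇔ Cond4 m A)
theorem4p4 n m A m≥2 _ ∣A∣≡m =
  mk⇔ (max⇒local A) (cond4⇒max ∘ cond3⇒cond4 ∘ local⇒cond3) ,
  mk⇔ (local⇒cond3 ∘ max⇒local A) (cond4⇒max ∘ cond3⇒cond4) ,
  mk⇔ (cond3⇒cond4 ∘ local⇒cond3 ∘ max⇒local A) cond4⇒max
  where
  count≡m : OnSubset.m A ≡ m
  count≡m = trans (sym (OnSubset.∣A∣≡m A)) ∣A∣≡m
  module OfA = Conditions A (subst (2 ≤_) (sym count≡m) m≥2)
  local⇒cond3 : LocalMaximizer A → Cond3 m A
  local⇒cond3 = subst (λ k → Cond3 k A) count≡m ∘ OfA.local⇒cond3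
  cond3⇒cond4 : Cond3 m A → Cond4 m A
  cond3⇒cond4 = subst (λ k → Cond4 k A) count≡m ∘ OfA.cond3⇒cond4 ∘ subst (λ k → Cond3 k A) (sym count≡m)
  cond4⇒max : Cond4 m A → Maximizer A
  cond4⇒max = cond4⇒maximizer A (subst (2 ≤_) (sym count≡m) m≥2) ∘ subst (λ k → Cond4 k A) (sym count≡m)
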